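{- Let $G$ be an $n$-vertex base graph with average degree $d^{\mathrm{av}}(G)\ge 1$. Then for every number of arrivals $T$, $\mathrm{OPT}(G,T)\ge 2T\rho^*(G)/(n\,d^{\mathrm{av}}(G))$, and for every $T\le n$, $\mathrm{OPT}(G,T)=\Omega\big(\log n/\log((n\,d^{\mathrm{av}}(G)/T)\cdot\log n)\big)$.
   Context: Given a base graph $G=(V,E)$ on $n$ vertices, $T$ edges are drawn independently and uniformly from $E$ (with replacement) forming a multigraph $G'_T$; $\mathrm{OPT}(G,T)$ is the expectation of the minimum, over all orientations of the edges of $G'_T$, of the maximum in-degree. $d^{\mathrm{av}}(G)=2|E|/n$; for a multigraph $H$, $\rho(H)=|E(H)|/|V(H)|$ and $\rho^*(H)=\max_{\emptyset\ne S\subseteq V(H)}\rho(H[S])$ over induced subgraphs. -}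

module Defs where

open import Data.Nat using (ℕ; zero; suc; _+_; _*_; _^_; _≤_; _<_; _⊔_; _⊓_; _≤?_)
open import Data.Nat.ListAction using (sum)
open import Data.Bool using (Bool; true; false; if_then_else_; _∧_)
open import Data.Fin using (Fin; toℕ) renaming (_≟_ to _≟ᶠ_)
open import Data.Fin.Subset using (Subset; ∣_∣)
open import Data.Vec using (Vec; []; _∷_; lookup)
open import Data.List using (List; []; _∷_; [_]; map; concatMap; allFin; filter; foldr; length; _++_)
open import Data.Product using (_×_; proj₁; proj₂)
open import Data.Integer using (+_)
open import Data.Rational using (ℚ; 0ℚ; _/_) renaming (_⊔_ to _⊔ℚ_)
open import Relation.Binary.PropositionalEquality using (_≡_)

-- A (simple) base graph on vertex set Fin n, with m = |E| edges listed
-- injectively as Fin m → E; each edge {u,v} is stored as (u , v) with u < v.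
record Graph (n : ℕ) : Set where
  field
    m        : ℕ
    edge     : Fin m → Fin n × Fin n
    ordered  : ∀ i → toℕ (proj₁ (edge i)) < toℕ (proj₂ (edge i))
    distinct : ∀ i j → edge i ≡ edge j → i ≡ j
open Graph public

-- a / b as a rational (the convention a / 0 = 0 is only a totality device;
-- it is never used with b = 0 under the hypotheses of the theorem).
frac : ℕ → ℕ → ℚ
frac a zero    = 0ℚ
frac a (suc b) = (+ a) / suc b

allSeqs : (T k : ℕ) → List (Vec (Fin k) T)
allSeqs zero    k = [ [] ]
allSeqs (suc T) k = concatMap (λ i → map (i ∷_) (allSeqs T k)) (allFin k)

allBools : (T : ℕ) → List (Vec Bool T)
allBools zero    = [ [] ]
allBools (suc T) = map (true ∷_) (allBools T) ++ map (false ∷_) (allBools T)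

allSubsets : (n : ℕ) → List (Subset n)
allSubsets zero    = [ [] ]
allSubsets (suc n) = map (true ∷_) (allSubsets n) ++ map (false ∷_) (allSubsets n)

maxList : List ℕ → ℕ
maxList = foldr _⊔_ 0

minList : List ℕ → ℕ
minList []           = 0
minList (x ∷ [])     = x
minList (x ∷ y ∷ ys) = x ⊓ minList (y ∷ ys)

module _ {n : ℕ} (G : Graph n) where

  -- Head of the t-th arrived edge (draw s t) under orientation o:
  -- o t = true orients it towards proj₂, false towards proj₁.
  head : {T : ℕ} → Vec (Fin (m G)) T → Vec Bool T → Fin T → Fin n
  head s o t = if lookup o t then proj₂ (edge G (lookup s t))
                             else proj₁ (edge G (lookup s t))

  indeg : {T : ℕ} → Vec (Fin (m G)) T → Vec Bool T → Fin n → ℕ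
  indeg {T} s o v = length (filter (λ t → head s o t ≟ᶠ v) (allFin T))

  maxIndeg : {T : ℕ} → Vec (Fin (m G)) T → Vec Bool T → ℕ
  maxIndeg s o = maxList (map (indeg s o) (allFin n))

  minMaxIndeg : {T : ℕ} → Vec (Fin (m G)) T → ℕ
  minMaxIndeg {T} s = minList (map (maxIndeg s) (allBools T))

  OPTsum : ℕ → ℕ
  OPTsum T = sum (map minMaxIndeg (allSeqs T (m G)))

  -- OPT(G,T) = expectation = OPTsum / |E|^T
  OPT : ℕ → ℚ
  OPT T = frac (OPTsum T) (m G ^ T)

  dav : ℚ
  dav = frac (2 * m G) n

  inducedEdges : Subset n → ℕ
  inducedEdges S = sum (map (λ i → if lookup S (proj₁ (edge G i)) ∧ lookup S (proj₂ (edge G i)) then 1 else 0) (allFin (m G)))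

  ρ : Subset n → ℚ
  ρ S = frac (inducedEdges S) ∣ S ∣

  ρ* : ℚ
  ρ* = foldr _⊔ℚ_ 0ℚ (map ρ (filter (λ S → 1 ≤? ∣ S ∣) (allSubsets n)))

-- Rational encoding of the real inequality
--   S/M ≥ (c₁/c₂) · log₂ n / log₂ ((2m/T) · log₂ n): with k = c₂·S it says ((2m/T)·log₂ n)^k ≥ n^(c₁·M), i.e.
-- log₂ n ≥ (n^(c₁M) T^k / (2m)^k)^(1/k), expressed via all rationals a/b
-- below the right-hand side, using  log₂ n ≥ a/b  ⇔  2^a ≤ n^b.
LogRatioBound : (c₁ c₂ n m T S M : ℕ) → Set
LogRatioBound c₁ c₂ n m T S M =
  ∀ a b → 1 ≤ b →
    (2 * m) ^ (c₂ * S) * a ^ (c₂ * S) < n ^ (c₁ * M) * T ^ (c₂ * S) * b ^ (c₂ * S) →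
    2 ^ a ≤ n ^ b

-- Density bound: in any orientation every arrival with both ends in S raises the
-- in-degree of a vertex of S, so |S| times the maximum in-degree is at least the
-- number of such arrivals, whose expectation is T·|E(G[S])|/|E|.
--
-- Logarithmic bound: an edge that arrives k times gives one of its endpoints
-- in-degree at least k/2 in every orientation.  Take the last k with
-- 256·(4k|E|)^k ≤ n·T^k.  Then the number Y of edges arriving exactly k times
-- has E[Y] ≥ 4 and E[Y²] ≤ E[Y] + (3/2)·E[Y]², because the multiplicities of
-- two distinct edges are nearly independent, so the second moment method gives
-- P(Y > 0) ≥ 1/4 and hence (k + 4)·|E|^T ≤ 12·OPTsum.  If n^b < 2^a, the failure
-- of the inequality at k + 1 gives n·(Tb)^(k+4) ≤ (2|E|a)^(k+4); raising it to
-- the power |E|^T yields n^(|E|^T)·(Tb)^(12·OPTsum) ≤ (2|E|a)^(12·OPTsum),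
-- which contradicts the premise of LogRatioBound.
{-# OPTIONS --safe #-}
module Submission where

open import Defs
open import Data.Nat
open import Data.Nat.Properties
open import Data.Nat.Combinatorics using (_C_; nC1≡n; k>n⇒nCk≡0; nCk+nC[k+1]≡[n+1]C[k+1])
open import Data.Nat.DivMod using (_/_; m≡m%n+[m/n]*n; m%n<n; m/n*n≤m; /-monoˡ-≤)
open import Data.Nat.ListAction using (sum)
open import Data.Nat.ListAction.Properties using (sum-++)
open import Data.Nat.Tactic.RingSolver using (solve-∀)
open import Data.Bool using (Bool; true; false; if_then_else_; _∧_) renaming (T to True)
open import Data.Unit using (tt)
open import Data.Fin using (Fin; zero; suc) renaming (_≟_ to _≟ᶠ_)
import Data.Fin.Properties as Finₚ
open import Data.Fin.Subset using (Subset; ∣_∣)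
open import Data.Vec using (Vec; []; _∷_; lookup)
open import Data.List using (List; []; _∷_; map; concatMap; allFin; filter; foldr; length; _++_)
open import Data.List.Properties using (map-++; map-tabulate; length-tabulate)
open import Data.List.Membership.Propositional using (_∈_)
open import Data.List.Membership.Propositional.Properties using (∈-allFin; ∈-map⁻; ∈-filter⁻)
open import Data.List.Relation.Unary.Any using (here; there)
open import Data.Product using (∃; ∃₂; _×_; _,_; proj₁; proj₂; Σ)
open import Data.Sum using (_⊎_; inj₁; inj₂; [_,_]′)
import Data.Integer as ℤ
import Data.Integer.Properties as ℤₚ
open import Data.Rational using (ℚ; 0ℚ; 1ℚ; toℚᵘ) renaming (_≤_ to _≤ℚ_; _*_ to _*ℚ_; _⊔_ to _⊔ℚ_)
import Data.Rational.Properties as ℚₚ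
open import Data.Rational.Unnormalised using (mkℚᵘ; *≤*) renaming (_≃_ to _≃ᵘ_)
import Data.Rational.Unnormalised.Properties as ℚᵘₚ
open import Function using (_∘_)
open import Level using (0ℓ)
open import Relation.Nullary using (¬_; does; yes; no; contradiction)
open import Relation.Nullary.Decidable using (dec-true; dec-false)
open import Relation.Unary using (Pred; Decidable)
open import Relation.Binary.PropositionalEquality
import Algebra.Properties.CommutativeSemigroup +-commutativeSemigroup as +-CS
import Algebra.Properties.CommutativeSemigroup *-commutativeSemigroup as *-CS

-- Written with if_then_else_ so that inducedEdges in Defs is literally a sum of 𝟙's.
𝟙 : Bool → ℕ
𝟙 b = if b then 1 else 0

𝟙≤1 : ∀ b → 𝟙 b ≤ 1
𝟙≤1 true  = ≤-refl
𝟙≤1 false = z≤n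

𝟙-idem : ∀ b → 𝟙 b * 𝟙 b ≡ 𝟙 b
𝟙-idem true  = refl
𝟙-idem false = refl

𝟙-∧-≤ˡ : ∀ a b → 𝟙 (a ∧ b) ≤ 𝟙 a
𝟙-∧-≤ˡ true  b = 𝟙≤1 b
𝟙-∧-≤ˡ false b = z≤n

𝟙-∧-≤ʳ : ∀ a b → 𝟙 (a ∧ b) ≤ 𝟙 b
𝟙-∧-≤ʳ true  b = ≤-refl
𝟙-∧-≤ʳ false b = z≤n

𝟙>0⇒True : ∀ b → 0 < 𝟙 b → True b
𝟙>0⇒True true _ = tt

∑ : {A : Set} → List A → (A → ℕ) → ℕ
∑ xs f = sum (map f xs)

∑-syntax : {A : Set} → List A → (A → ℕ) → ℕ
∑-syntax = ∑

infixl 10 ∑-syntax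
syntax ∑-syntax xs (λ x → e) = ∑[ x ∈ xs ] e


module _ {A : Set} where

  ∑-cong : ∀ (xs : List A) {f g : A → ℕ} → (∀ x → f x ≡ g x) → ∑ xs f ≡ ∑ xs g
  ∑-cong []       f≗g = refl
  ∑-cong (x ∷ xs) f≗g = cong₂ _+_ (f≗g x) (∑-cong xs f≗g)

  ∑-mono-≤ : ∀ (xs : List A) {f g : A → ℕ} → (∀ x → f x ≤ g x) → ∑ xs f ≤ ∑ xs g
  ∑-mono-≤ []       f≤g = z≤n
  ∑-mono-≤ (x ∷ xs) f≤g = +-mono-≤ (f≤g x) (∑-mono-≤ xs f≤g)

  ∑-distrib-+ : ∀ (xs : List A) (f g : A → ℕ) → ∑[ x ∈ xs ] (f x + g x) ≡ ∑ xs f + ∑ xs g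
  ∑-distrib-+ []       f g = refl
  ∑-distrib-+ (x ∷ xs) f g =
    trans (cong (f x + g x +_) (∑-distrib-+ xs f g)) (+-CS.interchange (f x) (g x) _ _)

  ∑-*-distribˡ : ∀ (xs : List A) c (f : A → ℕ) → ∑[ x ∈ xs ] (c * f x) ≡ c * ∑ xs f
  ∑-*-distribˡ []       c f = sym (*-zeroʳ c)
  ∑-*-distribˡ (x ∷ xs) c f =
    trans (cong (c * f x +_) (∑-*-distribˡ xs c f)) (sym (*-distribˡ-+ c (f x) _))

  ∑-*-distribʳ : ∀ (xs : List A) c (f : A → ℕ) → ∑[ x ∈ xs ] (f x * c) ≡ ∑ xs f * c
  ∑-*-distribʳ xs c f = trans (∑-cong xs (λ x → *-comm (f x) c)) (trans (∑-*-distribˡ xs c f) (*-comm c _))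

  ∑-const : ∀ (xs : List A) c → ∑[ _ ∈ xs ] c ≡ length xs * c
  ∑-const []       c = refl
  ∑-const (x ∷ xs) c = cong (c +_) (∑-const xs c)

  ∑-zero : ∀ (xs : List A) → ∑[ _ ∈ xs ] 0 ≡ 0
  ∑-zero xs = trans (∑-const xs 0) (*-zeroʳ (length xs))

  ∑-++ : ∀ (xs ys : List A) f → ∑ (xs ++ ys) f ≡ ∑ xs f + ∑ ys f
  ∑-++ xs ys f = trans (cong sum (map-++ f xs ys)) (sum-++ (map f xs) (map f ys))

  ∑>0⇒∃>0 : ∀ (xs : List A) f → 0 < ∑ xs f → ∃ λ x → 0 < f x
  ∑>0⇒∃>0 (x ∷ xs) f ∑>0 with f x in fx≡
  ... | zero  = ∑>0⇒∃>0 xs f ∑>0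
  ... | suc _ = x , subst (0 <_) (sym fx≡) z<s

module _ {A B : Set} where

  ∑-map : ∀ (xs : List A) (g : A → B) (f : B → ℕ) → ∑ (map g xs) f ≡ ∑[ x ∈ xs ] f (g x)
  ∑-map []       g f = refl
  ∑-map (x ∷ xs) g f = cong (f (g x) +_) (∑-map xs g f)

  ∑-concatMap : ∀ (xs : List A) (g : A → List B) (f : B → ℕ) →
                ∑ (concatMap g xs) f ≡ ∑[ x ∈ xs ] ∑ (g x) f
  ∑-concatMap []       g f = refl
  ∑-concatMap (x ∷ xs) g f =
    trans (∑-++ (g x) _ f) (cong (∑ (g x) f +_) (∑-concatMap xs g f))

  ∑-comm : ∀ (xs : List A) (ys : List B) (f : A → B → ℕ) →
           ∑[ x ∈ xs ] ∑[ y ∈ ys ] f x y ≡ ∑[ y ∈ ys ] ∑[ x ∈ xs ] f x y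
  ∑-comm []       ys f = sym (∑-zero ys)
  ∑-comm (x ∷ xs) ys f = trans (cong (∑ ys (f x) +_) (∑-comm xs ys f))
                               (sym (∑-distrib-+ ys (f x) (λ y → ∑[ x′ ∈ xs ] f x′ y)))

length-filter : ∀ {A : Set} {P : Pred A 0ℓ} (P? : Decidable P) (xs : List A) →
                length (filter P? xs) ≡ ∑[ x ∈ xs ] 𝟙 (does (P? x))
length-filter P? []       = refl
length-filter P? (x ∷ xs) with does (P? x)
... | true  = cong suc (length-filter P? xs)
... | false = length-filter P? xs

≤-maxList-map : ∀ {A : Set} (f : A → ℕ) {x} xs → x ∈ xs → f x ≤ maxList (map f xs)
≤-maxList-map f (y ∷ xs) (here refl) = m≤m⊔n (f y) _
≤-maxList-map f (y ∷ xs) (there x∈xs) = ≤-trans (≤-maxList-map f xs x∈xs) (m≤n⊔m (f y) _)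

minList-map-attained : ∀ {A : Set} (g : A → ℕ) x xs → ∃ λ y → minList (map g (x ∷ xs)) ≡ g y
minList-map-attained g x []       = x , refl
minList-map-attained g x (y ∷ xs) with ⊓-sel (g x) (minList (map g (y ∷ xs)))
... | inj₁ min≡gx   = x , min≡gx
... | inj₂ min≡rest with minList-map-attained g y xs
...   | z , rest≡gz = z , trans min≡rest rest≡gz


∑-allFin-suc : ∀ {m} (h : Fin (suc m) → ℕ) → ∑ (allFin (suc m)) h ≡ h zero + ∑[ x ∈ allFin m ] h (suc x)
∑-allFin-suc h = cong (λ xs → h zero + sum xs)
  (trans (map-tabulate suc h) (sym (map-tabulate (λ x → x) (λ x → h (suc x)))))

∑-allFin-const : ∀ m c → ∑[ _ ∈ allFin m ] c ≡ m * c
∑-allFin-const m c = trans (∑-const (allFin m) c) (cong (_* c) (length-tabulate {n = m} (λ x → x)))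

∑-allFin-except : ∀ {m} (e : Fin m) (h : Fin m → ℕ) c → (∀ x → x ≢ e → h x ≡ c) →
                  ∑ (allFin m) h ≡ h e + (m ∸ 1) * c
∑-allFin-except {suc m} zero h c h≡c =
  trans (∑-allFin-suc {m} h)
    (cong (h zero +_) (trans (∑-cong (allFin m) (λ x → h≡c (suc x) λ ())) (∑-allFin-const m c)))
∑-allFin-except {suc (suc m)} (suc e) h c h≡c =
  trans (∑-allFin-suc {suc m} h)
    (trans (cong₂ _+_ (h≡c zero λ ()) (∑-allFin-except e (λ x → h (suc x)) c
                                         (λ x x≢e → h≡c (suc x) (x≢e ∘ Finₚ.suc-injective))))
           (+-CS.x∙yz≈y∙xz c (h (suc e)) (m * c)))

𝟙[x≟x]≡1 : ∀ {m} (x : Fin m) → 𝟙 (does (x ≟ᶠ x)) ≡ 1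
𝟙[x≟x]≡1 x = cong 𝟙 (dec-true (x ≟ᶠ x) refl)

∑-indicator₁ : ∀ {m} (e : Fin m) (F : ℕ → ℕ) →
               ∑[ x ∈ allFin m ] F (𝟙 (does (x ≟ᶠ e))) ≡ F 1 + (m ∸ 1) * F 0
∑-indicator₁ {m} e F =
  trans (∑-allFin-except e _ (F 0) (λ x x≢e → cong (F ∘ 𝟙) (dec-false (x ≟ᶠ e) x≢e)))
        (cong (λ c → F c + (m ∸ 1) * F 0) (𝟙[x≟x]≡1 e))

∑-indicator₂ : ∀ {m} (e f : Fin m) → e ≢ f → (F : ℕ → ℕ → ℕ) →
               ∑[ x ∈ allFin m ] F (𝟙 (does (x ≟ᶠ e))) (𝟙 (does (x ≟ᶠ f)))
               ≡ F 1 0 + F 0 1 + (m ∸ 2) * F 0 0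
∑-indicator₂ zero zero e≢f F = contradiction refl e≢f
∑-indicator₂ {suc m} zero (suc f) _ F =
  trans (∑-allFin-suc {m} (λ x → F (𝟙 (does (x ≟ᶠ zero))) (𝟙 (does (x ≟ᶠ suc f)))))
    (trans (cong (F 1 0 +_) (∑-indicator₁ f (F 0))) (sym (+-assoc (F 1 0) (F 0 1) _)))
∑-indicator₂ {suc m} (suc e) zero _ F =
  trans (∑-allFin-suc {m} (λ x → F (𝟙 (does (x ≟ᶠ suc e))) (𝟙 (does (x ≟ᶠ zero)))))
    (trans (cong (F 0 1 +_) (∑-indicator₁ e (λ b → F b 0)))
      (trans (+-CS.x∙yz≈y∙xz (F 0 1) (F 1 0) _) (sym (+-assoc (F 1 0) (F 0 1) _))))
∑-indicator₂ {suc (suc zero)} (suc zero) (suc zero) e≢f F = contradiction refl e≢f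
∑-indicator₂ {suc (suc (suc m))} (suc e) (suc f) e≢f F =
  trans (∑-allFin-suc {suc (suc m)} (λ x → F (𝟙 (does (x ≟ᶠ suc e))) (𝟙 (does (x ≟ᶠ suc f)))))
    (trans (cong (F 0 0 +_) (∑-indicator₂ e f (λ e≡f → e≢f (cong suc e≡f)) F))
      (+-CS.x∙yz≈y∙xz (F 0 0) (F 1 0 + F 0 1) (m * F 0 0)))

∑-delta : ∀ {n} (x : Fin n) (h : Fin n → ℕ) → ∑[ v ∈ allFin n ] (h v * 𝟙 (does (x ≟ᶠ v))) ≡ h x
∑-delta {suc n} zero h = begin
  ∑[ v ∈ allFin (suc n) ] (h v * 𝟙 (does (zero ≟ᶠ v)))
    ≡⟨ ∑-allFin-suc {n} (λ v → h v * 𝟙 (does (zero ≟ᶠ v))) ⟩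
  h zero * 1 + ∑[ v ∈ allFin n ] (h (suc v) * 0)   ≡⟨ cong₂ _+_ (*-identityʳ (h zero))
                                                       (trans (∑-cong (allFin n) (λ v → *-zeroʳ (h (suc v))))
                                                              (∑-zero (allFin n))) ⟩
  h zero + 0                                        ≡⟨ +-identityʳ (h zero) ⟩
  h zero                                            ∎
  where open ≡-Reasoning
∑-delta {suc n} (suc x) h = begin
  ∑[ v ∈ allFin (suc n) ] (h v * 𝟙 (does (suc x ≟ᶠ v)))
    ≡⟨ ∑-allFin-suc {n} (λ v → h v * 𝟙 (does (suc x ≟ᶠ v))) ⟩
  h zero * 0 + ∑[ v ∈ allFin n ] (h (suc v) * 𝟙 (does (x ≟ᶠ v)))
    ≡⟨ cong₂ _+_ (*-zeroʳ (h zero)) (∑-delta x (λ v → h (suc v))) ⟩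
  h (suc x) ∎
  where open ≡-Reasoning

∑-lookup-Subset : ∀ {n} (S : Subset n) → ∑[ v ∈ allFin n ] 𝟙 (lookup S v) ≡ ∣ S ∣
∑-lookup-Subset []          = refl
∑-lookup-Subset {suc n} (b ∷ S) = trans (∑-allFin-suc {n} (λ v → 𝟙 (lookup (b ∷ S) v))) (lemma b)
  where
  lemma : ∀ b → 𝟙 b + ∑[ v ∈ allFin n ] 𝟙 (lookup S v) ≡ ∣ b ∷ S ∣
  lemma true  = cong suc (∑-lookup-Subset S)
  lemma false = ∑-lookup-Subset S

∑-allSeqs-suc : ∀ T m (f : Vec (Fin m) (suc T) → ℕ) →
                ∑ (allSeqs (suc T) m) f ≡ ∑[ x ∈ allFin m ] ∑[ s ∈ allSeqs T m ] f (x ∷ s)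
∑-allSeqs-suc T m f =
  trans (∑-concatMap (allFin m) _ f) (∑-cong (allFin m) (λ x → ∑-map (allSeqs T m) (x ∷_) f))

∑-allSeqs-const : ∀ T m c → ∑[ _ ∈ allSeqs T m ] c ≡ m ^ T * c
∑-allSeqs-const zero    m c = refl
∑-allSeqs-const (suc T) m c = begin
  ∑[ _ ∈ allSeqs (suc T) m ] c             ≡⟨ ∑-allSeqs-suc T m (λ _ → c) ⟩
  ∑[ _ ∈ allFin m ] ∑[ _ ∈ allSeqs T m ] c ≡⟨ ∑-cong (allFin m) (λ _ → ∑-allSeqs-const T m c) ⟩
  ∑[ _ ∈ allFin m ] (m ^ T * c)            ≡⟨ ∑-allFin-const m (m ^ T * c) ⟩
  m * (m ^ T * c)                          ≡⟨ *-assoc m (m ^ T) c ⟨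
  m ^ suc T * c                            ∎
  where open ≡-Reasoning

∑-lookup-∷ : ∀ {m T} (g : Fin m → ℕ) x (s : Vec (Fin m) T) →
             ∑[ t ∈ allFin (suc T) ] g (lookup (x ∷ s) t) ≡ g x + ∑[ t ∈ allFin T ] g (lookup s t)
∑-lookup-∷ {T = T} g x s = ∑-allFin-suc {T} (λ t → g (lookup (x ∷ s) t))

∑-allSeqs-∑-lookup : ∀ T m (g : Fin m → ℕ) →
  m * ∑[ s ∈ allSeqs T m ] ∑[ t ∈ allFin T ] g (lookup s t) ≡ T * ∑ (allFin m) g * m ^ T
∑-allSeqs-∑-lookup zero    m g = *-zeroʳ m
∑-allSeqs-∑-lookup (suc T) m g = begin
  m * ∑[ s ∈ allSeqs (suc T) m ] X s
    ≡⟨ cong (m *_) (∑-allSeqs-suc T m X) ⟩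
  m * ∑[ x ∈ allFin m ] ∑[ s ∈ allSeqs T m ] X (x ∷ s)
    ≡⟨ cong (m *_) (∑-cong (allFin m) (λ x → ∑-cong (allSeqs T m) (∑-lookup-∷ g x))) ⟩
  m * ∑[ x ∈ allFin m ] ∑[ s ∈ allSeqs T m ] (g x + X s)
    ≡⟨ cong (m *_) (∑-cong (allFin m) (λ x → ∑-distrib-+ (allSeqs T m) (λ _ → g x) X)) ⟩
  m * ∑[ x ∈ allFin m ] (∑[ _ ∈ allSeqs T m ] g x + ΣX)
    ≡⟨ cong (m *_) (∑-cong (allFin m) (λ x → cong (_+ ΣX) (∑-allSeqs-const T m (g x)))) ⟩
  m * ∑[ x ∈ allFin m ] (m ^ T * g x + ΣX)
    ≡⟨ cong (m *_) (∑-distrib-+ (allFin m) (λ x → m ^ T * g x) (λ _ → ΣX)) ⟩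
  m * (∑[ x ∈ allFin m ] (m ^ T * g x) + ∑[ _ ∈ allFin m ] ΣX)
    ≡⟨ cong₂ (λ a b → m * (a + b)) (∑-*-distribˡ (allFin m) (m ^ T) g) (∑-allFin-const m ΣX) ⟩
  m * (m ^ T * E + m * ΣX)
    ≡⟨ cong (λ z → m * (m ^ T * E + z)) (∑-allSeqs-∑-lookup T m g) ⟩
  m * (m ^ T * E + T * E * m ^ T)
    ≡⟨ lemma m (m ^ T) E T ⟩
  suc T * E * (m * m ^ T) ∎
  where
  open ≡-Reasoning
  X : ∀ {T} → Vec (Fin m) T → ℕ
  X {T} s = ∑[ t ∈ allFin T ] g (lookup s t)
  ΣX = ∑[ s ∈ allSeqs T m ] X s
  E = ∑ (allFin m) g
  lemma : ∀ m p e t → m * (p * e + t * e * p) ≡ suc t * e * (m * p)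
  lemma = solve-∀

allBools-nonempty : ∀ T → ∃₂ λ o os → allBools T ≡ o ∷ os
allBools-nonempty zero = [] , [] , refl
allBools-nonempty (suc T) with allBools-nonempty T
... | o , os , allBools≡ rewrite allBools≡ = true ∷ o , _ , refl

multiplicity : ∀ {m T} → Fin m → Vec (Fin m) T → ℕ
multiplicity {T = T} e s = ∑[ t ∈ allFin T ] 𝟙 (does (lookup s t ≟ᶠ e))

multiplicity-∷ : ∀ {m T} (e x : Fin m) (s : Vec (Fin m) T) →
                 multiplicity e (x ∷ s) ≡ 𝟙 (does (x ≟ᶠ e)) + multiplicity e s
multiplicity-∷ e = ∑-lookup-∷ (λ y → 𝟙 (does (y ≟ᶠ e)))


^-distrib-* : ∀ m n k → (m * n) ^ k ≡ m ^ k * n ^ k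
^-distrib-* m n zero    = refl
^-distrib-* m n (suc k) = trans (cong (m * n *_) (^-distrib-* m n k)) (lemma m n (m ^ k) (n ^ k))
  where
  lemma : ∀ a b c d → a * b * (c * d) ≡ a * c * (b * d)
  lemma = solve-∀

[1+k]*[1+n]C[1+k]≡[1+n]*nCk : ∀ n k → suc k * (suc n C suc k) ≡ suc n * (n C k)
[1+k]*[1+n]C[1+k]≡[1+n]*nCk zero    zero    = refl
[1+k]*[1+n]C[1+k]≡[1+n]*nCk zero    (suc k) = *-zeroʳ (suc (suc k))
[1+k]*[1+n]C[1+k]≡[1+n]*nCk (suc n) zero    =
  trans (*-identityˡ _) (trans (nC1≡n (suc (suc n))) (sym (*-identityʳ (suc (suc n)))))
[1+k]*[1+n]C[1+k]≡[1+n]*nCk (suc n) (suc k) = begin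
  suc (suc k) * (suc (suc n) C suc (suc k))
    ≡⟨ cong (suc (suc k) *_) (nCk+nC[k+1]≡[n+1]C[k+1] (suc n) (suc k)) ⟨
  suc (suc k) * (a + b)
    ≡⟨ lemma₁ a b k ⟩
  suc k * a + a + suc (suc k) * b
    ≡⟨ cong₂ (λ x y → x + a + y) ([1+k]*[1+n]C[1+k]≡[1+n]*nCk n k) ([1+k]*[1+n]C[1+k]≡[1+n]*nCk n (suc k)) ⟩
  suc n * (n C k) + a + suc n * (n C suc k)
    ≡⟨ lemma₂ (suc n) (n C k) (n C suc k) a ⟩
  suc n * (n C k + n C suc k) + a
    ≡⟨ cong (λ x → suc n * x + a) (nCk+nC[k+1]≡[n+1]C[k+1] n k) ⟩
  suc n * a + a
    ≡⟨ +-comm _ a ⟩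
  suc (suc n) * a ∎
  where
  open ≡-Reasoning
  a = suc n C suc k
  b = suc n C suc (suc k)
  lemma₁ : ∀ a b k → suc (suc k) * (a + b) ≡ suc k * a + a + suc (suc k) * b
  lemma₁ = solve-∀
  lemma₂ : ∀ t c d a → t * c + a + t * d ≡ t * (c + d) + a
  lemma₂ = solve-∀

[1+n∸k]^k≤nCk*k^k : ∀ n k → (suc n ∸ k) ^ k ≤ (n C k) * k ^ k
[1+n∸k]^k≤nCk*k^k n       zero    = ≤-refl
[1+n∸k]^k≤nCk*k^k zero    (suc k) = ≤-trans (≤-reflexive (cong (λ x → x * x ^ k) (0∸n≡0 k))) z≤n
[1+n∸k]^k≤nCk*k^k (suc n) (suc k) = begin
  (suc n ∸ k) * (suc n ∸ k) ^ k         ≤⟨ *-mono-≤ (m∸n≤m (suc n) k) ([1+n∸k]^k≤nCk*k^k n k) ⟩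
  suc n * ((n C k) * k ^ k)             ≤⟨ *-monoʳ-≤ (suc n) (*-monoʳ-≤ (n C k) (^-monoˡ-≤ k (n≤1+n k))) ⟩
  suc n * ((n C k) * suc k ^ k)         ≡⟨ *-assoc (suc n) (n C k) _ ⟨
  suc n * (n C k) * suc k ^ k           ≡⟨ cong (_* suc k ^ k) ([1+k]*[1+n]C[1+k]≡[1+n]*nCk n k) ⟨
  suc k * (suc n C suc k) * suc k ^ k   ≡⟨ lemma (suc k) (suc n C suc k) (suc k ^ k) ⟩
  (suc n C suc k) * (suc k * suc k ^ k) ∎
  where
  open ≤-Reasoning
  lemma : ∀ a b c → a * b * c ≡ b * (a * c)
  lemma = solve-∀

n^k≤nCk*[2k]^k : ∀ n k → 2 * k ≤ n → n ^ k ≤ (n C k) * (2 * k) ^ k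
n^k≤nCk*[2k]^k n k 2k≤n = begin
  n ^ k                     ≤⟨ ^-monoˡ-≤ k n≤2[1+n∸k] ⟩
  (2 * (suc n ∸ k)) ^ k     ≡⟨ ^-distrib-* 2 _ k ⟩
  2 ^ k * (suc n ∸ k) ^ k   ≤⟨ *-monoʳ-≤ (2 ^ k) ([1+n∸k]^k≤nCk*k^k n k) ⟩
  2 ^ k * ((n C k) * k ^ k) ≡⟨ *-CS.x∙yz≈y∙xz (2 ^ k) (n C k) (k ^ k) ⟩
  (n C k) * (2 ^ k * k ^ k) ≡⟨ cong ((n C k) *_) (^-distrib-* 2 k k) ⟨
  (n C k) * (2 * k) ^ k     ∎
  where
  open ≤-Reasoning
  n≤2[1+n∸k] : n ≤ 2 * (suc n ∸ k)
  n≤2[1+n∸k] = +-cancelʳ-≤ (2 * k) n _ (begin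
    n + 2 * k               ≤⟨ +-monoʳ-≤ n 2k≤n ⟩
    n + n                   ≡⟨ cong (n +_) (+-identityʳ n) ⟨
    2 * n                   ≤⟨ *-monoʳ-≤ 2 (n≤1+n n) ⟩
    2 * suc n               ≡⟨ cong (2 *_) (m∸n+n≡m k≤1+n) ⟨
    2 * (suc n ∸ k + k)     ≡⟨ *-distribˡ-+ 2 (suc n ∸ k) k ⟩
    2 * (suc n ∸ k) + 2 * k ∎)
    where
    k≤1+n : k ≤ suc n
    k≤1+n = ≤-trans (m≤m+n k (k + 0)) (≤-trans 2k≤n (n≤1+n n))

a*nC[1+k]*a^[n∸1+k]≡nC[1+k]*a^[n∸k] : ∀ a n k →
  a * ((n C suc k) * a ^ (n ∸ suc k)) ≡ (n C suc k) * a ^ (n ∸ k)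
a*nC[1+k]*a^[n∸1+k]≡nC[1+k]*a^[n∸k] a n k with k <? n
... | yes k<n = trans (*-CS.x∙yz≈y∙xz a (n C suc k) _)
                      (cong (λ e → (n C suc k) * a ^ e) (sym (+-∸-assoc 1 k<n)))
... | no  k≮n = begin
  a * ((n C suc k) * a ^ (n ∸ suc k)) ≡⟨ cong (λ c → a * (c * a ^ (n ∸ suc k))) nC[1+k]≡0 ⟩
  a * 0                               ≡⟨ *-zeroʳ a ⟩
  0                                   ≡⟨ cong (_* a ^ (n ∸ k)) nC[1+k]≡0 ⟨
  (n C suc k) * a ^ (n ∸ k)           ∎
  where
  open ≡-Reasoning
  nC[1+k]≡0 : n C suc k ≡ 0
  nC[1+k]≡0 = k>n⇒nCk≡0 (s≤s (≮⇒≥ k≮n))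

m*[m∸2]≤[m∸1]*[m∸1] : ∀ m → m * (m ∸ 2) ≤ (m ∸ 1) * (m ∸ 1)
m*[m∸2]≤[m∸1]*[m∸1] zero          = z≤n
m*[m∸2]≤[m∸1]*[m∸1] (suc zero)    = z≤n
m*[m∸2]≤[m∸1]*[m∸1] (suc (suc k)) =
  ≤-trans (≤-reflexive (lemma₁ k)) (≤-trans (m≤m+n _ 1) (≤-reflexive (lemma₂ k)))
  where
  lemma₁ : ∀ k → suc (suc k) * k ≡ k * k + 2 * k
  lemma₁ = solve-∀
  lemma₂ : ∀ k → k * k + 2 * k + 1 ≡ suc k * suc k
  lemma₂ = solve-∀

bernoulli : ∀ m j → m ^ j * (m ∸ j) ≤ m * (m ∸ 1) ^ j
bernoulli zero    j       = ≤-trans (≤-reflexive (trans (cong (0 ^ j *_) (0∸n≡0 j)) (*-zeroʳ (0 ^ j)))) z≤n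
bernoulli (suc n) zero    = ≤-reflexive (trans (+-identityʳ (suc n)) (sym (*-identityʳ (suc n))))
bernoulli (suc n) (suc j) = begin
  suc n * suc n ^ j * (n ∸ j)   ≡⟨ *-CS.xy∙z≈y∙xz (suc n) (suc n ^ j) (n ∸ j) ⟩
  suc n ^ j * (suc n * (n ∸ j)) ≤⟨ *-monoʳ-≤ (suc n ^ j) step ⟩
  suc n ^ j * ((suc n ∸ j) * n) ≡⟨ *-assoc (suc n ^ j) _ n ⟨
  suc n ^ j * (suc n ∸ j) * n   ≤⟨ *-monoˡ-≤ n (bernoulli (suc n) j) ⟩
  suc n * n ^ j * n             ≡⟨ trans (*-assoc (suc n) (n ^ j) n) (cong (suc n *_) (*-comm (n ^ j) n)) ⟩
  suc n * (n * n ^ j)           ∎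
  where
  open ≤-Reasoning
  step : suc n * (n ∸ j) ≤ (suc n ∸ j) * n
  step with j ≤? n
  ... | yes j≤n = begin
    suc n * (n ∸ j) ≤⟨ +-monoˡ-≤ (n * (n ∸ j)) (m∸n≤m n j) ⟩
    n + n * (n ∸ j) ≡⟨ cong (n +_) (*-comm n (n ∸ j)) ⟩
    suc (n ∸ j) * n ≡⟨ cong (_* n) (+-∸-assoc 1 j≤n) ⟨
    (suc n ∸ j) * n ∎
  ... | no  j≰n = begin
    suc n * (n ∸ j) ≡⟨ cong (suc n *_) (m≤n⇒m∸n≡0 (<⇒≤ (≰⇒> j≰n))) ⟩
    suc n * 0       ≡⟨ *-zeroʳ (suc n) ⟩
    0               ≤⟨ z≤n ⟩
    (suc n ∸ j) * n ∎

^-ratio : ∀ m j a b .{{_ : NonZero m}} → a * m ≤ b * (m ∸ j) → a * m ^ j ≤ b * (m ∸ 1) ^ j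
^-ratio m j a b am≤b[m∸j] = *-cancelˡ-≤ m (begin
  m * (a * m ^ j)       ≡⟨ *-assoc m a _ ⟨
  m * a * m ^ j         ≡⟨ cong (_* m ^ j) (*-comm m a) ⟩
  a * m * m ^ j         ≤⟨ *-monoˡ-≤ (m ^ j) am≤b[m∸j] ⟩
  b * (m ∸ j) * m ^ j   ≡⟨ trans (*-assoc b _ _) (cong (b *_) (*-comm (m ∸ j) _)) ⟩
  b * (m ^ j * (m ∸ j)) ≤⟨ *-monoʳ-≤ b (bernoulli m j) ⟩
  b * (m * (m ∸ 1) ^ j) ≡⟨ *-CS.x∙yz≈y∙xz b m _ ⟩
  m * (b * (m ∸ 1) ^ j) ∎)
  where open ≤-Reasoning

^-ratio-mono : ∀ {a b} c {T U} .{{_ : NonZero a}} → b ≤ a → T ≤ U →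
               a ^ U ≤ c * b ^ U → a ^ T ≤ c * b ^ T
^-ratio-mono {a} {b} c {T} {U} b≤a T≤U aᵁ≤cbᵁ =
  *-cancelʳ-≤ (a ^ T) (c * b ^ T) (a ^ (U ∸ T)) {{m^n≢0 a (U ∸ T)}} (begin
    a ^ T * a ^ (U ∸ T)     ≡⟨ ^-distribˡ-+-* a T (U ∸ T) ⟨
    a ^ (T + (U ∸ T))       ≡⟨ cong (a ^_) (m+[n∸m]≡n T≤U) ⟩
    a ^ U                   ≤⟨ aᵁ≤cbᵁ ⟩
    c * b ^ U               ≡⟨ cong (λ e → c * b ^ e) (m+[n∸m]≡n T≤U) ⟨
    c * b ^ (T + (U ∸ T))   ≡⟨ trans (cong (c *_) (^-distribˡ-+-* b T (U ∸ T))) (sym (*-assoc c _ _)) ⟩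
    c * b ^ T * b ^ (U ∸ T) ≤⟨ *-monoʳ-≤ (c * b ^ T) (^-monoˡ-≤ (U ∸ T) b≤a) ⟩
    c * b ^ T * a ^ (U ∸ T) ∎)
  where open ≤-Reasoning

m^T≤32*[m∸1]^T : ∀ m T → 4 ≤ m → T ≤ 2 * m → m ^ T ≤ 32 * (m ∸ 1) ^ T
m^T≤32*[m∸1]^T m@(suc _) T 4≤m T≤2m =
  ^-ratio-mono 32 (n≤1+n (m ∸ 1)) (≤-trans T≤2m 2m≤h*5) (begin
    m ^ (h * 5)            ≡⟨ ^-*-assoc m h 5 ⟨
    (m ^ h) ^ 5            ≤⟨ ^-monoˡ-≤ 5 mʰ≤2wʰ ⟩
    (2 * (m ∸ 1) ^ h) ^ 5  ≡⟨ ^-distrib-* 2 ((m ∸ 1) ^ h) 5 ⟩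
    32 * ((m ∸ 1) ^ h) ^ 5 ≡⟨ cong (32 *_) (^-*-assoc (m ∸ 1) h 5) ⟩
    32 * (m ∸ 1) ^ (h * 5) ∎)
  where
  open ≤-Reasoning
  h = m / 2
  2≤h : 2 ≤ h
  2≤h = /-monoˡ-≤ 2 4≤m
  h*2≤m : h * 2 ≤ m
  h*2≤m = m/n*n≤m m 2
  m≤1+h*2 : m ≤ 1 + h * 2
  m≤1+h*2 = ≤-trans (≤-reflexive (m≡m%n+[m/n]*n m 2)) (+-monoˡ-≤ (h * 2) (≤-pred (m%n<n m 2)))
  mʰ≤2wʰ : m ^ h ≤ 2 * (m ∸ 1) ^ h
  mʰ≤2wʰ = subst (_≤ 2 * (m ∸ 1) ^ h) (*-identityˡ (m ^ h)) (^-ratio m h 1 2 (+-cancelʳ-≤ (h * 2) _ _ (begin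
    1 * m + h * 2       ≤⟨ +-monoʳ-≤ (1 * m) (≤-trans h*2≤m (≤-reflexive (sym (*-identityˡ m)))) ⟩
    1 * m + 1 * m       ≡⟨ *-distribʳ-+ m 1 1 ⟨
    2 * m               ≡⟨ cong (2 *_) (m∸n+n≡m h≤m) ⟨
    2 * (m ∸ h + h)     ≡⟨ *-distribˡ-+ 2 (m ∸ h) h ⟩
    2 * (m ∸ h) + 2 * h ≡⟨ cong (2 * (m ∸ h) +_) (*-comm 2 h) ⟩
    2 * (m ∸ h) + h * 2 ∎)))
    where
    h≤m : h ≤ m
    h≤m = ≤-trans (m≤m*n h 2) h*2≤m
  2m≤h*5 : 2 * m ≤ h * 5
  2m≤h*5 = begin
    2 * m           ≤⟨ *-monoʳ-≤ 2 m≤1+h*2 ⟩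
    2 * (1 + h * 2) ≡⟨ lemma h ⟩
    2 + h * 4       ≤⟨ +-monoˡ-≤ (h * 4) 2≤h ⟩
    h + h * 4       ≡⟨ lemma′ h ⟩
    h * 5           ∎
    where
    lemma : ∀ h → 2 * (1 + h * 2) ≡ 2 + h * 4
    lemma = solve-∀
    lemma′ : ∀ h → h + h * 4 ≡ h * 5
    lemma′ = solve-∀

m≤m^[1+n] : ∀ m n → m ≤ m ^ suc n
m≤m^[1+n] zero    n = z≤n
m≤m^[1+n] (suc m) n = ≤-trans (≤-reflexive (sym (*-identityʳ (suc m)))) (*-monoʳ-≤ (suc m) (m^n>0 (suc m) n))

^-cancelʳ-< : ∀ {m n} k → m ^ k < n ^ k → m < n
^-cancelʳ-< {m} {n} k mᵏ<nᵏ with m <? n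
... | yes m<n = m<n
... | no  m≮n = contradiction (^-monoˡ-≤ k (≮⇒≥ m≮n)) (<⇒≱ mᵏ<nᵏ)

^-cancelˡ-< : ∀ m .{{_ : NonZero m}} {i j} → m ^ i < m ^ j → i < j
^-cancelˡ-< m {i} {j} mⁱ<mʲ with i <? j
... | yes i<j = i<j
... | no  i≮j = contradiction (^-monoʳ-≤ m (≮⇒≥ i≮j)) (<⇒≱ mⁱ<mʲ)

n*y^J≤x^J⇒n^M*y^K≤x^K : ∀ {n x y} J M K → n * y ^ J ≤ x ^ J → y ≤ x → J * M ≤ K → n ^ M * y ^ K ≤ x ^ K
n*y^J≤x^J⇒n^M*y^K≤x^K {n} {x} {y} J M K nyᴶ≤xᴶ y≤x JM≤K = begin
  n ^ M * y ^ K                 ≡⟨ cong (λ e → n ^ M * y ^ e) (m+[n∸m]≡n JM≤K) ⟨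
  n ^ M * y ^ (J * M + r)       ≡⟨ cong (n ^ M *_) (^-distribˡ-+-* y (J * M) r) ⟩
  n ^ M * (y ^ (J * M) * y ^ r) ≡⟨ *-assoc (n ^ M) _ _ ⟨
  n ^ M * y ^ (J * M) * y ^ r   ≡⟨ cong (λ z → n ^ M * z * y ^ r) (^-*-assoc y J M) ⟨
  n ^ M * (y ^ J) ^ M * y ^ r   ≡⟨ cong (_* y ^ r) (^-distrib-* n (y ^ J) M) ⟨
  (n * y ^ J) ^ M * y ^ r       ≤⟨ *-mono-≤ (^-monoˡ-≤ M nyᴶ≤xᴶ) (^-monoˡ-≤ r y≤x) ⟩
  (x ^ J) ^ M * x ^ r           ≡⟨ cong (_* x ^ r) (^-*-assoc x J M) ⟩
  x ^ (J * M) * x ^ r           ≡⟨ ^-distribˡ-+-* x (J * M) r ⟨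
  x ^ (J * M + r)               ≡⟨ cong (x ^_) (m+[n∸m]≡n JM≤K) ⟩
  x ^ K                         ∎
  where
  open ≤-Reasoning
  r = K ∸ J * M

4^[1+k]≤256*[2k]^k : ∀ k → 4 ^ suc k ≤ 256 * (2 * k) ^ k
4^[1+k]≤256*[2k]^k zero          = s≤s (s≤s (s≤s (s≤s z≤n)))
4^[1+k]≤256*[2k]^k (suc zero)    = m≤m+n 16 496
4^[1+k]≤256*[2k]^k (suc (suc k)) =
  *-mono-≤ {4} {256} (m≤m+n 4 252) (^-monoˡ-≤ (suc (suc k)) (*-monoʳ-≤ 2 (s≤s (s≤s (z≤n {k})))))

k<256*[2k]^k : ∀ k → k < 256 * (2 * k) ^ k
k<256*[2k]^k zero    = s≤s z≤n
k<256*[2k]^k (suc k) = begin-strict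
  suc k                     <⟨ m<m*n (suc k) 256 (s≤s (s≤s z≤n)) ⟩
  suc k * 256               ≡⟨ *-comm (suc k) 256 ⟩
  256 * suc k               ≤⟨ *-monoʳ-≤ 256 (≤-trans (m≤n*m (suc k) 2) (m≤m^[1+n] (2 * suc k) k)) ⟩
  256 * (2 * suc k) ^ suc k ∎
  where open ≤-Reasoning

boundary : ∀ {P : ℕ → Set} → Decidable P → P 0 → ∀ N → ¬ P N → ∃ λ k → P k × ¬ P (suc k)
boundary P? p₀ zero    ¬p₀ = contradiction p₀ ¬p₀
boundary P? p₀ (suc N) ¬pₙ with P? N
... | yes pₙ₋₁ = N , pₙ₋₁ , ¬pₙ
... | no ¬pₙ₋₁ = boundary P? p₀ N ¬pₙ₋₁


shift : (ℕ → ℕ) → ℕ → ℕ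
shift f zero    = 0
shift f (suc i) = f i

shift-≤-*ʳ : ∀ {f g : ℕ → ℕ} c → (∀ i → f i ≤ g i * c) → ∀ i → shift f i ≤ shift g i * c
shift-≤-*ʳ c f≤g*c zero    = z≤n
shift-≤-*ʳ c f≤g*c (suc i) = f≤g*c i

shift-≤-*ˡ : ∀ {f g : ℕ → ℕ} c → (∀ i → f i ≤ c * g i) → ∀ i → shift f i ≤ c * shift g i
shift-≤-*ˡ c f≤c*g zero    = z≤n
shift-≤-*ˡ c f≤c*g (suc i) = f≤c*g i

-- single T i: length-T sequences over m letters in which a fixed letter
-- occurs exactly i times; joint T i j: the same for two distinct letters
-- occurring i and j times.  The recurrences split on the first letter.
module Occurrences (m : ℕ) where

  single : ℕ → ℕ → ℕ
  single zero    i = 𝟙 (0 ≡ᵇ i)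
  single (suc T) i = shift (single T) i + (m ∸ 1) * single T i

  joint : ℕ → ℕ → ℕ → ℕ
  joint zero    i j = 𝟙 (0 ≡ᵇ i) * 𝟙 (0 ≡ᵇ j)
  joint (suc T) i j = shift (λ i′ → joint T i′ j) i + shift (joint T i) j + (m ∸ 2) * joint T i j

  count-single : ∀ T (e : Fin m) i →
                 ∑[ s ∈ allSeqs T m ] 𝟙 (multiplicity e s ≡ᵇ i) ≡ single T i
  count-single zero    e i = +-identityʳ _
  count-single (suc T) e i = begin
    ∑[ s ∈ allSeqs (suc T) m ] 𝟙 (multiplicity e s ≡ᵇ i)
      ≡⟨ ∑-allSeqs-suc T m _ ⟩
    ∑[ x ∈ allFin m ] ∑[ s ∈ allSeqs T m ] 𝟙 (multiplicity e (x ∷ s) ≡ᵇ i)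
      ≡⟨ ∑-cong (allFin m) (λ x → ∑-cong (allSeqs T m) (λ s →
           cong (λ c → 𝟙 (c ≡ᵇ i)) (multiplicity-∷ e x s))) ⟩
    ∑[ x ∈ allFin m ] F (𝟙 (does (x ≟ᶠ e)))
      ≡⟨ ∑-indicator₁ e F ⟩
    F 1 + (m ∸ 1) * F 0
      ≡⟨ cong₂ (λ a b → a + (m ∸ 1) * b) (first-hit i) (count-single T e i) ⟩
    single (suc T) i ∎
    where
    open ≡-Reasoning
    F : ℕ → ℕ
    F b = ∑[ s ∈ allSeqs T m ] 𝟙 (b + multiplicity e s ≡ᵇ i)
    first-hit : ∀ i′ → ∑[ s ∈ allSeqs T m ] 𝟙 (suc (multiplicity e s) ≡ᵇ i′) ≡ shift (single T) i′
    first-hit zero     = ∑-zero (allSeqs T m)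
    first-hit (suc i′) = count-single T e i′

  count-joint : ∀ T (e f : Fin m) → e ≢ f → ∀ i j →
                ∑[ s ∈ allSeqs T m ] (𝟙 (multiplicity e s ≡ᵇ i) * 𝟙 (multiplicity f s ≡ᵇ j))
                ≡ joint T i j
  count-joint zero    e f e≢f i j = +-identityʳ _
  count-joint (suc T) e f e≢f i j = begin
    ∑[ s ∈ allSeqs (suc T) m ] (𝟙 (multiplicity e s ≡ᵇ i) * 𝟙 (multiplicity f s ≡ᵇ j))
      ≡⟨ ∑-allSeqs-suc T m _ ⟩
    ∑[ x ∈ allFin m ] ∑[ s ∈ allSeqs T m ]
      (𝟙 (multiplicity e (x ∷ s) ≡ᵇ i) * 𝟙 (multiplicity f (x ∷ s) ≡ᵇ j))
      ≡⟨ ∑-cong (allFin m) (λ x → ∑-cong (allSeqs T m) (λ s →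
           cong₂ (λ c d → 𝟙 (c ≡ᵇ i) * 𝟙 (d ≡ᵇ j)) (multiplicity-∷ e x s) (multiplicity-∷ f x s))) ⟩
    ∑[ x ∈ allFin m ] F (𝟙 (does (x ≟ᶠ e))) (𝟙 (does (x ≟ᶠ f)))
      ≡⟨ ∑-indicator₂ e f e≢f F ⟩
    F 1 0 + F 0 1 + (m ∸ 2) * F 0 0
      ≡⟨ cong₂ (λ a b → a + b + (m ∸ 2) * F 0 0) (first-hits-e i) (first-hits-f j) ⟩
    shift (λ i′ → joint T i′ j) i + shift (joint T i) j + (m ∸ 2) * F 0 0
      ≡⟨ cong (λ c → shift (λ i′ → joint T i′ j) i + shift (joint T i) j + (m ∸ 2) * c)
              (count-joint T e f e≢f i j) ⟩
    joint (suc T) i j ∎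
    where
    open ≡-Reasoning
    F : ℕ → ℕ → ℕ
    F b c = ∑[ s ∈ allSeqs T m ] (𝟙 (b + multiplicity e s ≡ᵇ i) * 𝟙 (c + multiplicity f s ≡ᵇ j))
    first-hits-e : ∀ i′ → ∑[ s ∈ allSeqs T m ] (𝟙 (suc (multiplicity e s) ≡ᵇ i′) * 𝟙 (multiplicity f s ≡ᵇ j))
                          ≡ shift (λ i″ → joint T i″ j) i′
    first-hits-e zero     = ∑-zero (allSeqs T m)
    first-hits-e (suc i′) = count-joint T e f e≢f i′ j
    first-hits-f : ∀ j′ → ∑[ s ∈ allSeqs T m ] (𝟙 (multiplicity e s ≡ᵇ i) * 𝟙 (suc (multiplicity f s) ≡ᵇ j′))
                          ≡ shift (joint T i) j′
    first-hits-f zero     = trans (∑-cong (allSeqs T m) (λ s → *-zeroʳ (𝟙 (multiplicity e s ≡ᵇ i))))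
                                  (∑-zero (allSeqs T m))
    first-hits-f (suc j′) = count-joint T e f e≢f i j′

  single≡C*[m∸1]^ : ∀ T i → single T i ≡ (T C i) * (m ∸ 1) ^ (T ∸ i)
  single≡C*[m∸1]^ zero    zero    = refl
  single≡C*[m∸1]^ zero    (suc i) = refl
  single≡C*[m∸1]^ (suc T) zero    = begin
    (m ∸ 1) * single T 0        ≡⟨ cong ((m ∸ 1) *_) (single≡C*[m∸1]^ T 0) ⟩
    (m ∸ 1) * (1 * (m ∸ 1) ^ T) ≡⟨ cong ((m ∸ 1) *_) (*-identityˡ _) ⟩
    (m ∸ 1) ^ suc T             ≡⟨ *-identityˡ _ ⟨
    1 * (m ∸ 1) ^ suc T         ∎
    where open ≡-Reasoning
  single≡C*[m∸1]^ (suc T) (suc i) = begin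
    single T i + (m ∸ 1) * single T (suc i)
      ≡⟨ cong₂ (λ x y → x + (m ∸ 1) * y) (single≡C*[m∸1]^ T i) (single≡C*[m∸1]^ T (suc i)) ⟩
    (T C i) * (m ∸ 1) ^ (T ∸ i) + (m ∸ 1) * ((T C suc i) * (m ∸ 1) ^ (T ∸ suc i))
      ≡⟨ cong ((T C i) * (m ∸ 1) ^ (T ∸ i) +_) (a*nC[1+k]*a^[n∸1+k]≡nC[1+k]*a^[n∸k] (m ∸ 1) T i) ⟩
    (T C i) * (m ∸ 1) ^ (T ∸ i) + (T C suc i) * (m ∸ 1) ^ (T ∸ i)
      ≡⟨ *-distribʳ-+ ((m ∸ 1) ^ (T ∸ i)) (T C i) (T C suc i) ⟨
    (T C i + T C suc i) * (m ∸ 1) ^ (T ∸ i)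
      ≡⟨ cong (_* (m ∸ 1) ^ (T ∸ i)) (nCk+nC[k+1]≡[n+1]C[k+1] T i) ⟩
    (suc T C suc i) * (m ∸ 1) ^ (T ∸ i) ∎
    where open ≡-Reasoning

  scaledSingle : ℕ → ℕ → ℕ
  scaledSingle T i = single T i * m ^ i

  scaledJoint : ℕ → ℕ → ℕ → ℕ
  scaledJoint T i j = joint T i j * m ^ T * (m ∸ 1) ^ i * (m ∸ 1) ^ j

  scaledSingle-suc : ∀ T i →
    scaledSingle (suc T) i ≡ m * shift (scaledSingle T) i + (m ∸ 1) * scaledSingle T i
  scaledSingle-suc T zero    = lemma m (m ∸ 1) (single T 0)
    where
    lemma : ∀ m w s → (0 + w * s) * 1 ≡ m * 0 + w * (s * 1)
    lemma = solve-∀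
  scaledSingle-suc T (suc i) = lemma m (m ∸ 1) (single T i) (single T (suc i)) (m ^ i)
    where
    lemma : ∀ m w s₁ s₂ p → (s₁ + w * s₂) * (m * p) ≡ m * (s₁ * p) + w * (s₂ * (m * p))
    lemma = solve-∀

  scaledJoint-suc : ∀ T i j → scaledJoint (suc T) i j ≡
    m * (m ∸ 1) * shift (λ i′ → scaledJoint T i′ j) i + m * (m ∸ 1) * shift (scaledJoint T i) j
    + m * (m ∸ 2) * scaledJoint T i j
  scaledJoint-suc T zero    zero    =
    lemma m (m ∸ 1) (m ∸ 2) (joint T 0 0) (m ^ T)
    where
    lemma : ∀ m w d b p → (0 + 0 + d * b) * (m * p) * 1 * 1 ≡ m * w * 0 + m * w * 0 + m * d * (b * p * 1 * 1)
    lemma = solve-∀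
  scaledJoint-suc T zero    (suc j) =
    lemma m (m ∸ 1) (m ∸ 2) (joint T 0 j) (joint T 0 (suc j)) (m ^ T) ((m ∸ 1) ^ j)
    where
    lemma : ∀ m w d b₁ b₂ p q → (0 + b₁ + d * b₂) * (m * p) * 1 * (w * q)
            ≡ m * w * 0 + m * w * (b₁ * p * 1 * q) + m * d * (b₂ * p * 1 * (w * q))
    lemma = solve-∀
  scaledJoint-suc T (suc i) zero    =
    lemma m (m ∸ 1) (m ∸ 2) (joint T i 0) (joint T (suc i) 0) (m ^ T) ((m ∸ 1) ^ i)
    where
    lemma : ∀ m w d b₁ b₂ p q → (b₁ + 0 + d * b₂) * (m * p) * (w * q) * 1
            ≡ m * w * (b₁ * p * q * 1) + m * w * 0 + m * d * (b₂ * p * (w * q) * 1)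
    lemma = solve-∀
  scaledJoint-suc T (suc i) (suc j) =
    lemma m (m ∸ 1) (m ∸ 2) (joint T i (suc j)) (joint T (suc i) j) (joint T (suc i) (suc j))
          (m ^ T) ((m ∸ 1) ^ i) ((m ∸ 1) ^ j)
    where
    lemma : ∀ m w d b₁ b₂ b₃ p q r → (b₁ + b₂ + d * b₃) * (m * p) * (w * q) * (w * r)
            ≡ m * w * (b₁ * p * q * (w * r)) + m * w * (b₂ * p * (w * q) * r)
              + m * d * (b₃ * p * (w * q) * (w * r))
    lemma = solve-∀

  -- With N_e the multiplicity of e in a uniform sequence of T draws:
  -- P(N_e = i, N_f = j) ≤ P(N_e = i) · P(N_f = j) · (m/(m−1))^(i+j).
  scaledJoint≤scaledSingle² : ∀ T i j → scaledJoint T i j ≤ scaledSingle T i * scaledSingle T j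
  scaledJoint≤scaledSingle² zero    zero    zero    = ≤-refl
  scaledJoint≤scaledSingle² zero    zero    (suc j) = z≤n
  scaledJoint≤scaledSingle² zero    (suc i) j       = z≤n
  scaledJoint≤scaledSingle² (suc T) i       j       = begin
    scaledJoint (suc T) i j
      ≡⟨ scaledJoint-suc T i j ⟩
    m * w * shift (λ i′ → scaledJoint T i′ j) i + m * w * shift (scaledJoint T i) j
    + m * (m ∸ 2) * scaledJoint T i j
      ≤⟨ +-mono-≤ (+-mono-≤
           (*-monoʳ-≤ (m * w) (shift-≤-*ʳ (a j) (λ i′ → scaledJoint≤scaledSingle² T i′ j) i))
           (*-monoʳ-≤ (m * w) (shift-≤-*ˡ (a i) (scaledJoint≤scaledSingle² T i) j)))
           (*-mono-≤ (m*[m∸2]≤[m∸1]*[m∸1] m) (scaledJoint≤scaledSingle² T i j)) ⟩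
    m * w * (shift a i * a j) + m * w * (a i * shift a j) + w * w * (a i * a j)
      ≤⟨ m≤n+m _ (m * m * (shift a i * shift a j)) ⟩
    m * m * (shift a i * shift a j)
    + (m * w * (shift a i * a j) + m * w * (a i * shift a j) + w * w * (a i * a j))
      ≡⟨ lemma m w (shift a i) (a i) (shift a j) (a j) ⟩
    (m * shift a i + w * a i) * (m * shift a j + w * a j)
      ≡⟨ cong₂ _*_ (scaledSingle-suc T i) (scaledSingle-suc T j) ⟨
    scaledSingle (suc T) i * scaledSingle (suc T) j ∎
    where
    open ≤-Reasoning
    w = m ∸ 1
    a = scaledSingle T
    lemma : ∀ m w x y u v → m * m * (x * u) + (m * w * (x * v) + m * w * (y * u) + w * w * (y * v))
            ≡ (m * x + w * y) * (m * u + w * v)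
    lemma = solve-∀


-- The second moment method

2xy≤x²+y² : ∀ x y → 2 * x * y ≤ x * x + y * y
2xy≤x²+y² x y with ≤-total x y
... | inj₁ x≤y with m≤n⇒∃[o]m+o≡n x≤y
...   | r , refl = ≤-trans (m≤m+n _ (r * r)) (≤-reflexive (lemma x r))
  where
  lemma : ∀ x r → 2 * x * (x + r) + r * r ≡ x * x + (x + r) * (x + r)
  lemma = solve-∀
2xy≤x²+y² x y | inj₂ y≤x with m≤n⇒∃[o]m+o≡n y≤x
...   | r , refl = ≤-trans (m≤m+n _ (r * r)) (≤-reflexive (lemma y r))
  where
  lemma : ∀ y r → 2 * (y + r) * y + r * r ≡ (y + r) * (y + r) + y * y
  lemma = solve-∀

2aby≤a²y²+b²[y>0] : ∀ a b y → 2 * a * b * y ≤ a * a * (y * y) + b * b * 𝟙 (0 <ᵇ y)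
2aby≤a²y²+b²[y>0] a b zero    = ≤-trans (≤-reflexive (*-zeroʳ (2 * a * b))) z≤n
2aby≤a²y²+b²[y>0] a b (suc y) =
  subst₂ _≤_ (lemma₁ a b (suc y)) (lemma₂ a b (suc y)) (2xy≤x²+y² (a * suc y) b)
  where
  lemma₁ : ∀ a b y → 2 * (a * y) * b ≡ 2 * a * b * y
  lemma₁ = solve-∀
  lemma₂ : ∀ a b y → a * y * (a * y) + b * b ≡ a * a * (y * y) + b * b * 1
  lemma₂ = solve-∀

paley-zygmund-arith : ∀ M E Q Z → 4 * M ≤ E → 2 * M * Q ≤ 2 * M * E + 3 * (E * E) →
                      2 * M * E * E ≤ M * M * Q + E * E * Z → M ≤ 4 * Z
paley-zygmund-arith M zero      Q Z 4M≤0 _ _ = ≤-trans (m≤n*m M 4) (≤-trans 4M≤0 z≤n)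
paley-zygmund-arith M E@(suc _) Q Z 4M≤E 2MQ≤2ME+3E² 2MEE≤M²Q+E²Z =
  *-cancelˡ-≤ (E * E) (+-cancelˡ-≤ (7 * (M * E * E)) _ _ (begin
    7 * (M * E * E) + E * E * M                  ≡⟨ lemma₁ M E ⟩
    4 * (2 * M * E * E)                          ≤⟨ *-monoʳ-≤ 4 2MEE≤M²Q+E²Z ⟩
    4 * (M * M * Q + E * E * Z)                  ≡⟨ lemma₂ M E Q Z ⟩
    2 * M * (2 * M * Q) + 4 * (E * E * Z)        ≤⟨ +-monoˡ-≤ _ (*-monoʳ-≤ (2 * M) 2MQ≤2ME+3E²) ⟩
    2 * M * (2 * M * E + 3 * (E * E)) + 4 * (E * E * Z)
                                                 ≡⟨ lemma₃ M E (4 * (E * E * Z)) ⟩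
    4 * M * (M * E) + 6 * (M * E * E) + 4 * (E * E * Z)
                                                 ≤⟨ +-monoˡ-≤ _ (+-monoˡ-≤ _ (*-monoˡ-≤ (M * E) 4M≤E)) ⟩
    E * (M * E) + 6 * (M * E * E) + 4 * (E * E * Z)
                                                 ≡⟨ lemma₄ M E Z ⟩
    7 * (M * E * E) + E * E * (4 * Z)            ∎))
  where
  open ≤-Reasoning
  lemma₁ : ∀ M E → 7 * (M * E * E) + E * E * M ≡ 4 * (2 * M * E * E)
  lemma₁ = solve-∀
  lemma₂ : ∀ M E Q Z → 4 * (M * M * Q + E * E * Z) ≡ 2 * M * (2 * M * Q) + 4 * (E * E * Z)
  lemma₂ = solve-∀
  lemma₃ : ∀ M E X → 2 * M * (2 * M * E + 3 * (E * E)) + X ≡ 4 * M * (M * E) + 6 * (M * E * E) + X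
  lemma₃ = solve-∀
  lemma₄ : ∀ M E Z → E * (M * E) + 6 * (M * E * E) + 4 * (E * E * Z) ≡ 7 * (M * E * E) + E * E * (4 * Z)
  lemma₄ = solve-∀

-- Summing 2·M·E·Y ≤ M²·Y² + E²·[Y > 0] gives 2·M·E² ≤ M²·∑ Y² + E²·#{Y > 0},
-- the integer form of the Paley–Zygmund inequality.
second-moment-method : ∀ {A : Set} (xs : List A) (Y : A → ℕ) M →
  4 * M ≤ ∑ xs Y →
  2 * M * ∑[ x ∈ xs ] (Y x * Y x) ≤ 2 * M * ∑ xs Y + 3 * (∑ xs Y * ∑ xs Y) →
  M ≤ 4 * ∑[ x ∈ xs ] 𝟙 (0 <ᵇ Y x)
second-moment-method xs Y M 4M≤E 2MQ≤2ME+3E² =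
  paley-zygmund-arith M E (∑[ x ∈ xs ] (Y x * Y x)) (∑[ x ∈ xs ] 𝟙 (0 <ᵇ Y x)) 4M≤E 2MQ≤2ME+3E² (begin
    2 * M * E * E
      ≡⟨ ∑-*-distribˡ xs (2 * M * E) Y ⟨
    ∑[ x ∈ xs ] (2 * M * E * Y x)
      ≤⟨ ∑-mono-≤ xs (λ x → 2aby≤a²y²+b²[y>0] M E (Y x)) ⟩
    ∑[ x ∈ xs ] (M * M * (Y x * Y x) + E * E * 𝟙 (0 <ᵇ Y x))
      ≡⟨ ∑-distrib-+ xs _ _ ⟩
    ∑[ x ∈ xs ] (M * M * (Y x * Y x)) + ∑[ x ∈ xs ] (E * E * 𝟙 (0 <ᵇ Y x))
      ≡⟨ cong₂ _+_ (∑-*-distribˡ xs (M * M) (λ x → Y x * Y x)) (∑-*-distribˡ xs (E * E) (λ x → 𝟙 (0 <ᵇ Y x))) ⟩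
    M * M * ∑[ x ∈ xs ] (Y x * Y x) + E * E * ∑[ x ∈ xs ] 𝟙 (0 <ᵇ Y x) ∎)
  where
  open ≤-Reasoning
  E = ∑ xs Y


toℚᵘ-frac : ∀ a b → toℚᵘ (frac a (suc b)) ≃ᵘ mkℚᵘ (ℤ.+ a) b
toℚᵘ-frac a b = ℚₚ.toℚᵘ-fromℚᵘ (mkℚᵘ (ℤ.+ a) b)

frac-* : ∀ a b c d → frac a (suc b) *ℚ frac c (suc d) ≡ frac (a * c) (suc b * suc d)
frac-* a b c d = ℚₚ.toℚᵘ-injective (begin
  toℚᵘ (frac a (suc b) *ℚ frac c (suc d))
    ≈⟨ ℚₚ.toℚᵘ-homo-* (frac a (suc b)) (frac c (suc d)) ⟩
  _ ≈⟨ ℚᵘₚ.*-cong (toℚᵘ-frac a b) (toℚᵘ-frac c d) ⟩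
  mkℚᵘ (ℤ.+ a ℤ.* ℤ.+ c) (d + b * suc d)
    ≡⟨ cong (λ z → mkℚᵘ z (d + b * suc d)) (sym (ℤₚ.pos-* a c)) ⟩
  mkℚᵘ (ℤ.+ (a * c)) (d + b * suc d)
    ≈⟨ ℚᵘₚ.≃-sym (toℚᵘ-frac (a * c) (d + b * suc d)) ⟩
  toℚᵘ (frac (a * c) (suc b * suc d)) ∎)
  where open ℚᵘₚ.≃-Reasoning

frac-≤ : ∀ a b c d → a * suc d ≤ c * suc b → frac a (suc b) ≤ℚ frac c (suc d)
frac-≤ a b c d ad≤cb =
  ℚₚ.toℚᵘ-cancel-≤ (ℚᵘₚ.≤-respˡ-≃ (ℚᵘₚ.≃-sym (toℚᵘ-frac a b)) (ℚᵘₚ.≤-respʳ-≃ (ℚᵘₚ.≃-sym (toℚᵘ-frac c d))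
    (*≤* (subst₂ ℤ._≤_ (ℤₚ.pos-* a (suc d)) (ℤₚ.pos-* c (suc b)) (ℤ.+≤+ ad≤cb)))))

frac-≤⁻ : ∀ a b c d → frac a (suc b) ≤ℚ frac c (suc d) → a * suc d ≤ c * suc b
frac-≤⁻ a b c d p≤q
  with ℚᵘₚ.≤-respˡ-≃ (toℚᵘ-frac a b) (ℚᵘₚ.≤-respʳ-≃ (toℚᵘ-frac c d) (ℚₚ.toℚᵘ-mono-≤ p≤q))
... | *≤* ad≤cb = ℤₚ.drop‿+≤+ (subst₂ ℤ._≤_ (sym (ℤₚ.pos-* a (suc d))) (sym (ℤₚ.pos-* c (suc b))) ad≤cb)

foldr-⊔-attained : ∀ (xs : List ℚ) → foldr _⊔ℚ_ 0ℚ xs ≡ 0ℚ ⊎ ∃ λ x → x ∈ xs × foldr _⊔ℚ_ 0ℚ xs ≡ x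
foldr-⊔-attained []       = inj₁ refl
foldr-⊔-attained (x ∷ xs) with ℚₚ.⊔-sel x (foldr _⊔ℚ_ 0ℚ xs)
... | inj₁ max≡x    = inj₂ (x , here refl , max≡x)
... | inj₂ max≡rest with foldr-⊔-attained xs
...   | inj₁ rest≡0            = inj₁ (trans max≡rest rest≡0)
...   | inj₂ (y , y∈xs , rest≡y) = inj₂ (y , there y∈xs , trans max≡rest rest≡y)

frac-cross-≤ : ∀ T e s O M n m → 0 < s → 0 < M → 0 < n → T * e * M ≤ m * (s * O) →
  frac (2 * T) 1 *ℚ frac e s ≤ℚ frac O M *ℚ (frac n 1 *ℚ frac (2 * m) n)
frac-cross-≤ T e (suc s) O (suc M) (suc n) m _ _ _ TeM≤msO =
  subst₂ _≤ℚ_ (sym (frac-* (2 * T) 0 e s))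
              (sym (trans (cong (frac O (suc M) *ℚ_) (frac-* (suc n) 0 (2 * m) n))
                          (frac-* O M (suc n * (2 * m)) (n + 0))))
    (frac-≤ (2 * T * e) (s + 0) (O * (suc n * (2 * m))) (n + 0 + M * suc (n + 0)) (begin
      2 * T * e * (suc M * (1 * suc n))   ≡⟨ lemma₁ T e (suc M) (suc n) ⟩
      2 * suc n * (T * e * suc M)         ≤⟨ *-monoʳ-≤ (2 * suc n) TeM≤msO ⟩
      2 * suc n * (m * (suc s * O))       ≡⟨ lemma₂ (suc n) m (suc s) O ⟩
      O * (suc n * (2 * m)) * (1 * suc s) ∎))
  where
  open ≤-Reasoning
  lemma₁ : ∀ T e M N → 2 * T * e * (M * (1 * N)) ≡ 2 * N * (T * e * M)
  lemma₁ = solve-∀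
  lemma₂ : ∀ N m S O → 2 * N * (m * (S * O)) ≡ O * (N * (2 * m)) * (1 * S)
  lemma₂ = solve-∀


module _ {n : ℕ} (G : Graph n) where
  open Occurrences (m G)

  indeg≡∑ : ∀ {T} (s : Vec (Fin (m G)) T) o v →
            indeg G s o v ≡ ∑[ t ∈ allFin T ] 𝟙 (does (head G s o t ≟ᶠ v))
  indeg≡∑ {T} s o v = length-filter (λ t → head G s o t ≟ᶠ v) (allFin T)

  indeg≤maxIndeg : ∀ {T} (s : Vec (Fin (m G)) T) o v → indeg G s o v ≤ maxIndeg G s o
  indeg≤maxIndeg s o v = ≤-maxList-map (indeg G s o) (allFin n) (∈-allFin v)

  minMaxIndeg-attained : ∀ {T} (s : Vec (Fin (m G)) T) → ∃ λ o → minMaxIndeg G s ≡ maxIndeg G s o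
  minMaxIndeg-attained {T} s with allBools-nonempty T
  ... | o , os , allBools≡ rewrite allBools≡ = minList-map-attained (maxIndeg G s) o os

  drawn≤head-at-endpoint : ∀ {T} (s : Vec (Fin (m G)) T) o t e →
    𝟙 (does (lookup s t ≟ᶠ e)) ≤ 𝟙 (does (head G s o t ≟ᶠ proj₁ (edge G e)))
                                + 𝟙 (does (head G s o t ≟ᶠ proj₂ (edge G e)))
  drawn≤head-at-endpoint s o t e with lookup s t ≟ᶠ e
  ... | no  _    = z≤n
  ... | yes refl with lookup o t
  ...   | true  = ≤-trans (≤-reflexive (sym (𝟙[x≟x]≡1 (proj₂ (edge G (lookup s t)))))) (m≤n+m _ _)
  ...   | false = ≤-trans (≤-reflexive (sym (𝟙[x≟x]≡1 (proj₁ (edge G (lookup s t)))))) (m≤m+n _ _)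

  multiplicity≤2*minMaxIndeg : ∀ {T} (s : Vec (Fin (m G)) T) e → multiplicity e s ≤ 2 * minMaxIndeg G s
  multiplicity≤2*minMaxIndeg {T} s e with minMaxIndeg-attained s
  ... | o , mmi≡ = begin
    multiplicity e s
      ≤⟨ ∑-mono-≤ (allFin T) (λ t → drawn≤head-at-endpoint s o t e) ⟩
    ∑[ t ∈ allFin T ] (𝟙 (does (head G s o t ≟ᶠ u)) + 𝟙 (does (head G s o t ≟ᶠ v)))
      ≡⟨ ∑-distrib-+ (allFin T) _ _ ⟩
    ∑[ t ∈ allFin T ] 𝟙 (does (head G s o t ≟ᶠ u)) + ∑[ t ∈ allFin T ] 𝟙 (does (head G s o t ≟ᶠ v))
      ≡⟨ cong₂ _+_ (indeg≡∑ s o u) (indeg≡∑ s o v) ⟨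
    indeg G s o u + indeg G s o v
      ≤⟨ +-mono-≤ (indeg≤maxIndeg s o u) (≤-trans (indeg≤maxIndeg s o v) (≤-reflexive (sym (+-identityʳ _)))) ⟩
    maxIndeg G s o + (maxIndeg G s o + 0)
      ≡⟨ cong (λ x → x + (x + 0)) mmi≡ ⟨
    2 * minMaxIndeg G s ∎
    where
    open ≤-Reasoning
    u = proj₁ (edge G e)
    v = proj₂ (edge G e)

  minMaxIndeg>0 : ∀ {T} (s : Vec (Fin (m G)) (suc T)) → 0 < minMaxIndeg G s
  minMaxIndeg>0 (x ∷ s) with minMaxIndeg G (x ∷ s) | multiplicity≤2*minMaxIndeg (x ∷ s) x
  ... | suc _ | _       = z<s
  ... | zero  | mult≤0  = contradiction (≤-trans 1≤mult mult≤0) λ ()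
    where
    1≤mult : 1 ≤ multiplicity x (x ∷ s)
    1≤mult = ≤-trans (≤-trans (≤-reflexive (sym (𝟙[x≟x]≡1 x))) (m≤m+n _ _))
                     (≤-reflexive (sym (multiplicity-∷ x x s)))

  m^T≤OPTsum : ∀ T → 0 < T → m G ^ T ≤ OPTsum G T
  m^T≤OPTsum (suc T) _ = begin
    m G ^ suc T                      ≡⟨ *-identityʳ _ ⟨
    m G ^ suc T * 1                  ≡⟨ ∑-allSeqs-const (suc T) (m G) 1 ⟨
    ∑[ _ ∈ allSeqs (suc T) (m G) ] 1 ≤⟨ ∑-mono-≤ (allSeqs (suc T) (m G)) minMaxIndeg>0 ⟩
    OPTsum G (suc T)                 ∎
    where open ≤-Reasoning

  inside : Subset n → Fin (m G) → ℕ
  inside S e = 𝟙 (lookup S (proj₁ (edge G e)) ∧ lookup S (proj₂ (edge G e)))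

  inside≤𝟙[head∈S] : ∀ {T} S (s : Vec (Fin (m G)) T) o t → inside S (lookup s t) ≤ 𝟙 (lookup S (head G s o t))
  inside≤𝟙[head∈S] S s o t with lookup o t
  ... | true  = 𝟙-∧-≤ʳ (lookup S (proj₁ (edge G (lookup s t)))) _
  ... | false = 𝟙-∧-≤ˡ _ (lookup S (proj₂ (edge G (lookup s t))))

  ∑-inside≤|S|*minMaxIndeg : ∀ {T} S (s : Vec (Fin (m G)) T) →
    ∑[ t ∈ allFin T ] inside S (lookup s t) ≤ ∣ S ∣ * minMaxIndeg G s
  ∑-inside≤|S|*minMaxIndeg {T} S s with minMaxIndeg-attained s
  ... | o , mmi≡ = begin
    ∑[ t ∈ allFin T ] inside S (lookup s t)
      ≤⟨ ∑-mono-≤ (allFin T) (inside≤𝟙[head∈S] S s o) ⟩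
    ∑[ t ∈ allFin T ] 𝟙 (lookup S (head G s o t))
      ≡⟨ ∑-cong (allFin T) (λ t → ∑-delta (head G s o t) (λ v → 𝟙 (lookup S v))) ⟨
    ∑[ t ∈ allFin T ] ∑[ v ∈ allFin n ] (𝟙 (lookup S v) * 𝟙 (does (head G s o t ≟ᶠ v)))
      ≡⟨ ∑-comm (allFin T) (allFin n) _ ⟩
    ∑[ v ∈ allFin n ] ∑[ t ∈ allFin T ] (𝟙 (lookup S v) * 𝟙 (does (head G s o t ≟ᶠ v)))
      ≡⟨ ∑-cong (allFin n) (λ v → trans (∑-*-distribˡ (allFin T) (𝟙 (lookup S v)) _)
                                         (cong (𝟙 (lookup S v) *_) (sym (indeg≡∑ s o v)))) ⟩
    ∑[ v ∈ allFin n ] (𝟙 (lookup S v) * indeg G s o v)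
      ≤⟨ ∑-mono-≤ (allFin n) (λ v → *-monoʳ-≤ (𝟙 (lookup S v)) (indeg≤maxIndeg s o v)) ⟩
    ∑[ v ∈ allFin n ] (𝟙 (lookup S v) * maxIndeg G s o)
      ≡⟨ ∑-*-distribʳ (allFin n) (maxIndeg G s o) (λ v → 𝟙 (lookup S v)) ⟩
    ∑[ v ∈ allFin n ] 𝟙 (lookup S v) * maxIndeg G s o
      ≡⟨ cong₂ _*_ (∑-lookup-Subset S) (sym mmi≡) ⟩
    ∣ S ∣ * minMaxIndeg G s ∎
    where open ≤-Reasoning

  T*e[S]*m^T≤m*|S|*OPTsum : ∀ S T → T * inducedEdges G S * m G ^ T ≤ m G * (∣ S ∣ * OPTsum G T)
  T*e[S]*m^T≤m*|S|*OPTsum S T = begin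
    T * inducedEdges G S * m G ^ T
      ≡⟨ ∑-allSeqs-∑-lookup T (m G) (inside S) ⟨
    m G * ∑[ s ∈ allSeqs T (m G) ] ∑[ t ∈ allFin T ] inside S (lookup s t)
      ≤⟨ *-monoʳ-≤ (m G) (∑-mono-≤ (allSeqs T (m G)) (∑-inside≤|S|*minMaxIndeg S)) ⟩
    m G * ∑[ s ∈ allSeqs T (m G) ] (∣ S ∣ * minMaxIndeg G s)
      ≡⟨ cong (m G *_) (∑-*-distribˡ (allSeqs T (m G)) ∣ S ∣ (minMaxIndeg G)) ⟩
    m G * (∣ S ∣ * OPTsum G T) ∎
    where open ≤-Reasoning

  ρ*-attained : ρ* G ≡ 0ℚ ⊎ ∃ λ S → 0 < ∣ S ∣ × ρ* G ≡ ρ G S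
  ρ*-attained with foldr-⊔-attained (map (ρ G) (filter (λ S → 1 ≤? ∣ S ∣) (allSubsets n)))
  ... | inj₁ ρ*≡0            = inj₁ ρ*≡0
  ... | inj₂ (x , x∈ , ρ*≡x) with ∈-map⁻ (ρ G) x∈
  ...   | S , S∈ , x≡ρS = inj₂ (S , proj₂ (∈-filter⁻ (λ S → 1 ≤? ∣ S ∣) {xs = allSubsets n} S∈) , trans ρ*≡x x≡ρS)

  exactly : ∀ {T} → ℕ → Vec (Fin (m G)) T → ℕ
  exactly k s = ∑[ e ∈ allFin (m G) ] 𝟙 (multiplicity e s ≡ᵇ k)

  ∑-exactly : ∀ T k → ∑[ s ∈ allSeqs T (m G) ] exactly k s ≡ m G * single T k
  ∑-exactly T k = begin
    ∑[ s ∈ allSeqs T (m G) ] ∑[ e ∈ allFin (m G) ] 𝟙 (multiplicity e s ≡ᵇ k)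
      ≡⟨ ∑-comm (allSeqs T (m G)) (allFin (m G)) _ ⟩
    ∑[ e ∈ allFin (m G) ] ∑[ s ∈ allSeqs T (m G) ] 𝟙 (multiplicity e s ≡ᵇ k)
      ≡⟨ ∑-cong (allFin (m G)) (λ e → count-single T e k) ⟩
    ∑[ e ∈ allFin (m G) ] single T k
      ≡⟨ ∑-allFin-const (m G) (single T k) ⟩
    m G * single T k ∎
    where open ≡-Reasoning

  ∑-exactly² : ∀ T k → ∑[ s ∈ allSeqs T (m G) ] (exactly k s * exactly k s)
                       ≡ m G * (single T k + (m G ∸ 1) * joint T k k)
  ∑-exactly² T k = begin
    ∑[ s ∈ allSeqs T (m G) ] (exactly k s * exactly k s)
      ≡⟨ ∑-cong (allSeqs T (m G)) exactly²≡∑∑ ⟩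
    ∑[ s ∈ allSeqs T (m G) ] ∑[ e ∈ allFin (m G) ] ∑[ f ∈ allFin (m G) ] (hit s e * hit s f)
      ≡⟨ ∑-comm (allSeqs T (m G)) (allFin (m G)) _ ⟩
    ∑[ e ∈ allFin (m G) ] ∑[ s ∈ allSeqs T (m G) ] ∑[ f ∈ allFin (m G) ] (hit s e * hit s f)
      ≡⟨ ∑-cong (allFin (m G)) (λ e → ∑-comm (allSeqs T (m G)) (allFin (m G)) _) ⟩
    ∑[ e ∈ allFin (m G) ] ∑[ f ∈ allFin (m G) ] ∑[ s ∈ allSeqs T (m G) ] (hit s e * hit s f)
      ≡⟨ ∑-cong (allFin (m G)) (λ e → ∑-allFin-except e _ (joint T k k)
                                         (λ f f≢e → count-joint T e f (f≢e ∘ sym) k k)) ⟩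
    ∑[ e ∈ allFin (m G) ] (∑[ s ∈ allSeqs T (m G) ] (hit s e * hit s e) + (m G ∸ 1) * joint T k k)
      ≡⟨ ∑-cong (allFin (m G)) (λ e → cong (_+ (m G ∸ 1) * joint T k k)
           (trans (∑-cong (allSeqs T (m G)) (λ s → 𝟙-idem (multiplicity e s ≡ᵇ k))) (count-single T e k))) ⟩
    ∑[ e ∈ allFin (m G) ] (single T k + (m G ∸ 1) * joint T k k)
      ≡⟨ ∑-allFin-const (m G) _ ⟩
    m G * (single T k + (m G ∸ 1) * joint T k k) ∎
    where
    open ≡-Reasoning
    hit : Vec (Fin (m G)) T → Fin (m G) → ℕ
    hit s e = 𝟙 (multiplicity e s ≡ᵇ k)
    exactly²≡∑∑ : ∀ s → exactly k s * exactly k s ≡ ∑[ e ∈ allFin (m G) ] ∑[ f ∈ allFin (m G) ] (hit s e * hit s f)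
    exactly²≡∑∑ s = trans (sym (∑-*-distribʳ (allFin (m G)) (exactly k s) (hit s)))
                         (∑-cong (allFin (m G)) (λ e → sym (∑-*-distribˡ (allFin (m G)) (hit s e) (hit s))))

  k*[exactly>0]≤2*minMaxIndeg : ∀ {T} k (s : Vec (Fin (m G)) T) →
                                k * 𝟙 (0 <ᵇ exactly k s) ≤ 2 * minMaxIndeg G s
  k*[exactly>0]≤2*minMaxIndeg k s with exactly k s in exactly≡
  ... | zero  = ≤-trans (≤-reflexive (*-zeroʳ k)) z≤n
  ... | suc _ with ∑>0⇒∃>0 (allFin (m G)) (λ e → 𝟙 (multiplicity e s ≡ᵇ k)) (subst (0 <_) (sym exactly≡) z<s)
  ...   | e , 0<hit = begin
    k * 1               ≡⟨ *-identityʳ k ⟩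
    k                   ≡⟨ ≡ᵇ⇒≡ (multiplicity e s) k (𝟙>0⇒True (multiplicity e s ≡ᵇ k) 0<hit) ⟨
    multiplicity e s    ≤⟨ multiplicity≤2*minMaxIndeg s e ⟩
    2 * minMaxIndeg G s ∎
    where open ≤-Reasoning

  k*m^T≤8*OPTsum : ∀ T k → 4 * m G ^ T ≤ m G * single T k →
                   2 * m G ^ T * ((m G ∸ 1) * joint T k k) ≤ 3 * m G * (single T k * single T k) →
                   k * m G ^ T ≤ 8 * OPTsum G T
  k*m^T≤8*OPTsum T k 4M≤mA 2MwB≤3mA² = begin
    k * M                                        ≤⟨ *-monoʳ-≤ k M≤4Z ⟩
    k * (4 * Z)                                  ≡⟨ *-CS.x∙yz≈y∙xz k 4 Z ⟩
    4 * (k * Z)                                  ≡⟨ cong (4 *_) (∑-*-distribˡ seqs k _) ⟨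
    4 * ∑[ s ∈ seqs ] (k * 𝟙 (0 <ᵇ exactly k s)) ≤⟨ *-monoʳ-≤ 4 (∑-mono-≤ seqs (k*[exactly>0]≤2*minMaxIndeg k)) ⟩
    4 * ∑[ s ∈ seqs ] (2 * minMaxIndeg G s)      ≡⟨ cong (4 *_) (∑-*-distribˡ seqs 2 (minMaxIndeg G)) ⟩
    4 * (2 * OPTsum G T)                         ≡⟨ *-assoc 4 2 (OPTsum G T) ⟨
    8 * OPTsum G T                               ∎
    where
    open ≤-Reasoning
    M = m G ^ T
    A = single T k
    seqs = allSeqs T (m G)
    Z = ∑[ s ∈ seqs ] 𝟙 (0 <ᵇ exactly k s)
    M≤4Z : M ≤ 4 * Z
    M≤4Z = second-moment-method seqs (exactly k) M
      (subst (4 * M ≤_) (sym (∑-exactly T k)) 4M≤mA)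
      (subst₂ (λ Q E → 2 * M * Q ≤ 2 * M * E + 3 * (E * E)) (sym (∑-exactly² T k)) (sym (∑-exactly T k)) (begin
        2 * M * (m G * (A + (m G ∸ 1) * joint T k k))
          ≡⟨ lemma₁ M (m G) A ((m G ∸ 1) * joint T k k) ⟩
        2 * M * (m G * A) + m G * (2 * M * ((m G ∸ 1) * joint T k k))
          ≤⟨ +-monoʳ-≤ (2 * M * (m G * A)) (*-monoʳ-≤ (m G) 2MwB≤3mA²) ⟩
        2 * M * (m G * A) + m G * (3 * m G * (A * A))
          ≡⟨ cong (2 * M * (m G * A) +_) (lemma₂ (m G) A) ⟩
        2 * M * (m G * A) + 3 * (m G * A * (m G * A)) ∎))
      where
      lemma₁ : ∀ M m A P → 2 * M * (m * (A + P)) ≡ 2 * M * (m * A) + m * (2 * M * P)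
      lemma₁ = solve-∀
      lemma₂ : ∀ m A → m * (3 * m * (A * A)) ≡ 3 * (m * A * (m * A))
      lemma₂ = solve-∀


-- The density bound

1≤dav⇒0<n≤2m : ∀ {n} (G : Graph n) → 1ℚ ≤ℚ dav G → 0 < n × n ≤ 2 * m G
1≤dav⇒0<n≤2m {zero}  G 1≤0   = contradiction (frac-≤⁻ 1 0 0 0 1≤0) λ ()
1≤dav⇒0<n≤2m {suc n} G 1≤dav =
  z<s , subst₂ _≤_ (+-identityʳ (suc n)) (*-identityʳ (2 * m G)) (frac-≤⁻ 1 0 (2 * m G) n 1≤dav)

density-lower-bound : (n : ℕ) (G : Graph n) → 1ℚ ≤ℚ dav G → (T : ℕ) →
  frac (2 * T) 1 *ℚ ρ* G ≤ℚ OPT G T *ℚ (frac n 1 *ℚ dav G)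
density-lower-bound n G 1≤dav T = [ via-zero , via-densest ]′ (ρ*-attained G)
  where
  Bound : ℚ → Set
  Bound r = frac (2 * T) 1 *ℚ r ≤ℚ OPT G T *ℚ (frac n 1 *ℚ dav G)
  0<n = proj₁ (1≤dav⇒0<n≤2m G 1≤dav)
  0<m : 0 < m G
  0<m = *-cancelˡ-< 2 0 (m G) (≤-trans 0<n (proj₂ (1≤dav⇒0<n≤2m G 1≤dav)))
  bound : ∀ e s → 0 < s → T * e * m G ^ T ≤ m G * (s * OPTsum G T) → Bound (frac e s)
  bound e s 0<s = frac-cross-≤ T e s (OPTsum G T) (m G ^ T) n (m G) 0<s (m^n>0 (m G) {{>-nonZero 0<m}} T) 0<n
  via-zero : ρ* G ≡ 0ℚ → Bound (ρ* G)
  via-zero ρ*≡0 = subst Bound (sym ρ*≡0)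
    (bound 0 1 z<s (≤-trans (≤-reflexive (cong (_* m G ^ T) (*-zeroʳ T))) z≤n))
  via-densest : (∃ λ S → 0 < ∣ S ∣ × ρ* G ≡ ρ G S) → Bound (ρ* G)
  via-densest (S , 0<|S| , ρ*≡ρS) = subst Bound (sym ρ*≡ρS)
    (bound (inducedEdges G S) ∣ S ∣ 0<|S| (T*e[S]*m^T≤m*|S|*OPTsum G S T))


-- The logarithmic bound

module LogBound {n : ℕ} (G : Graph n) (256≤n : 256 ≤ n) (n≤2m : n ≤ 2 * m G) (T : ℕ) (T≤n : T ≤ n) where
  open Occurrences (m G)

  Feasible : ℕ → Set
  Feasible k = 256 * (4 * k * m G) ^ k ≤ n * T ^ k

  128≤m : 128 ≤ m G
  128≤m = *-cancelˡ-≤ 2 (≤-trans 256≤n n≤2m)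

  instance
    n≢0 : NonZero n
    n≢0 = >-nonZero (≤-trans (s≤s z≤n) 256≤n)
    m≢0 : NonZero (m G)
    m≢0 = >-nonZero (≤-trans (s≤s z≤n) 128≤m)
    m∸1≢0 : NonZero (m G ∸ 1)
    m∸1≢0 = >-nonZero (∸-monoˡ-≤ 1 (≤-trans (s≤s (s≤s z≤n)) 128≤m))

  256*[2k]^k*n^k≤n*T^k : ∀ k → Feasible k → 256 * (2 * k) ^ k * n ^ k ≤ n * T ^ k
  256*[2k]^k*n^k≤n*T^k k feasible = begin
    256 * (2 * k) ^ k * n ^ k   ≡⟨ *-assoc 256 ((2 * k) ^ k) (n ^ k) ⟩
    256 * ((2 * k) ^ k * n ^ k) ≡⟨ cong (256 *_) (^-distrib-* (2 * k) n k) ⟨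
    256 * (2 * k * n) ^ k       ≤⟨ *-monoʳ-≤ 256 (^-monoˡ-≤ k 2kn≤4km) ⟩
    256 * (4 * k * m G) ^ k     ≤⟨ feasible ⟩
    n * T ^ k                   ∎
    where
    open ≤-Reasoning
    2kn≤4km : 2 * k * n ≤ 4 * k * m G
    2kn≤4km = ≤-trans (*-monoʳ-≤ (2 * k) n≤2m) (≤-reflexive (lemma k (m G)))
      where
      lemma : ∀ k m → 2 * k * (2 * m) ≡ 4 * k * m
      lemma = solve-∀

  feasible⇒256*[2k]^k≤n : ∀ k → Feasible k → 256 * (2 * k) ^ k ≤ n
  feasible⇒256*[2k]^k≤n k feasible = *-cancelʳ-≤ (256 * (2 * k) ^ k) n (n ^ k) {{m^n≢0 n k}}
    (≤-trans (256*[2k]^k*n^k≤n*T^k k feasible) (*-monoʳ-≤ n (^-monoˡ-≤ k T≤n)))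

  feasible⇒256*[2k]^k≤T^k : ∀ k → 0 < k → Feasible k → 256 * (2 * k) ^ k ≤ T ^ k
  feasible⇒256*[2k]^k≤T^k k@(suc k′) _ feasible = *-cancelʳ-≤ (256 * (2 * k) ^ k) (T ^ k) (n ^ k) {{m^n≢0 n k}}
    (≤-trans (256*[2k]^k*n^k≤n*T^k k feasible)
      (≤-trans (*-monoˡ-≤ (T ^ k) (m≤m^[1+n] n k′)) (≤-reflexive (*-comm (n ^ k) (T ^ k)))))

  feasible⇒k<n : ∀ k → Feasible k → k < n
  feasible⇒k<n k feasible = <-≤-trans (k<256*[2k]^k k) (feasible⇒256*[2k]^k≤n k feasible)

  feasible⇒2k≤T : ∀ k → 0 < k → Feasible k → 2 * k ≤ T
  feasible⇒2k≤T k@(suc _) 0<k feasible = <⇒≤ (^-cancelʳ-< k (begin-strict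
    (2 * k) ^ k       <⟨ m<m*n ((2 * k) ^ k) 256 {{m^n≢0 (2 * k) k}} (s≤s (s≤s z≤n)) ⟩
    (2 * k) ^ k * 256 ≡⟨ *-comm ((2 * k) ^ k) 256 ⟩
    256 * (2 * k) ^ k ≤⟨ feasible⇒256*[2k]^k≤T^k k 0<k feasible ⟩
    T ^ k             ∎))
    where open ≤-Reasoning

  feasible⇒6k≤m : ∀ k → 0 < k → Feasible k → 6 * k ≤ m G
  feasible⇒6k≤m k@(suc k′) _ feasible = *-cancelˡ-≤ 2 (begin
    2 * (6 * k)       ≡⟨ *-CS.x∙yz≈y∙xz 2 6 k ⟩
    6 * (2 * k)       ≤⟨ *-monoˡ-≤ (2 * k) (m≤m+n 6 250) ⟩
    256 * (2 * k)     ≤⟨ *-monoʳ-≤ 256 (m≤m^[1+n] (2 * k) k′) ⟩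
    256 * (2 * k) ^ k ≤⟨ feasible⇒256*[2k]^k≤n k feasible ⟩
    n                 ≤⟨ n≤2m ⟩
    2 * m G           ∎)
    where open ≤-Reasoning

  T≤2m : T ≤ 2 * m G
  T≤2m = ≤-trans T≤n n≤2m

  feasible⇒128*m^k≤m*TCk : ∀ k → 0 < k → Feasible k → 128 * m G ^ k ≤ m G * (T C k)
  feasible⇒128*m^k≤m*TCk k@(suc _) 0<k feasible = *-cancelˡ-≤ ((2 * k) ^ k) {{m^n≢0 (2 * k) k}} (begin
    (2 * k) ^ k * (128 * m G ^ k)    ≡⟨ *-CS.x∙yz≈y∙xz ((2 * k) ^ k) 128 (m G ^ k) ⟩
    128 * ((2 * k) ^ k * m G ^ k)    ≡⟨ cong (128 *_) (^-distrib-* (2 * k) (m G) k) ⟨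
    128 * (2 * k * m G) ^ k          ≤⟨ *-monoʳ-≤ 128 (^-monoˡ-≤ k (*-monoˡ-≤ (m G) (*-monoˡ-≤ k (m≤m+n 2 2)))) ⟩
    128 * (4 * k * m G) ^ k          ≤⟨ *-cancelˡ-≤ 2 (begin
      2 * (128 * (4 * k * m G) ^ k)    ≡⟨ *-assoc 2 128 ((4 * k * m G) ^ k) ⟨
      256 * (4 * k * m G) ^ k          ≤⟨ feasible ⟩
      n * T ^ k                        ≤⟨ *-monoˡ-≤ (T ^ k) n≤2m ⟩
      2 * m G * T ^ k                  ≡⟨ *-assoc 2 (m G) (T ^ k) ⟩
      2 * (m G * T ^ k)                ∎) ⟩
    m G * T ^ k                      ≤⟨ *-monoʳ-≤ (m G) (n^k≤nCk*[2k]^k T k (feasible⇒2k≤T k 0<k feasible)) ⟩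
    m G * ((T C k) * (2 * k) ^ k)    ≡⟨ *-CS.x∙yz≈z∙xy (m G) (T C k) ((2 * k) ^ k) ⟩
    (2 * k) ^ k * (m G * (T C k))    ∎)
    where open ≤-Reasoning

  feasible⇒4*m^T≤m*single : ∀ k → 0 < k → Feasible k → 4 * m G ^ T ≤ m G * single T k
  feasible⇒4*m^T≤m*single k 0<k feasible =
    *-cancelˡ-≤ (32 * m G ^ k) {{m*n≢0 32 (m G ^ k) {{_}} {{m^n≢0 (m G) k}}}} (begin
      32 * m G ^ k * (4 * m G ^ T)
        ≡⟨ lemma₁ (m G ^ k) (m G ^ T) ⟩
      128 * m G ^ k * m G ^ T
        ≤⟨ *-monoˡ-≤ (m G ^ T) (feasible⇒128*m^k≤m*TCk k 0<k feasible) ⟩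
      m G * (T C k) * m G ^ T
        ≤⟨ *-monoʳ-≤ (m G * (T C k)) (m^T≤32*[m∸1]^T (m G) T 4≤m T≤2m) ⟩
      m G * (T C k) * (32 * w ^ T)
        ≡⟨ cong (λ e → m G * (T C k) * (32 * e)) wᵀ≡ ⟩
      m G * (T C k) * (32 * (w ^ (T ∸ k) * w ^ k))
        ≤⟨ *-monoʳ-≤ (m G * (T C k)) (*-monoʳ-≤ 32 (*-monoʳ-≤ (w ^ (T ∸ k)) (^-monoˡ-≤ k (m∸n≤m (m G) 1)))) ⟩
      m G * (T C k) * (32 * (w ^ (T ∸ k) * m G ^ k))
        ≡⟨ lemma₂ (m G) (T C k) (w ^ (T ∸ k)) (m G ^ k) ⟩
      32 * m G ^ k * (m G * ((T C k) * w ^ (T ∸ k)))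
        ≡⟨ cong (λ s → 32 * m G ^ k * (m G * s)) (single≡C*[m∸1]^ T k) ⟨
      32 * m G ^ k * (m G * single T k) ∎)
    where
    open ≤-Reasoning
    w = m G ∸ 1
    4≤m : 4 ≤ m G
    4≤m = ≤-trans (m≤m+n 4 124) 128≤m
    wᵀ≡ : w ^ T ≡ w ^ (T ∸ k) * w ^ k
    wᵀ≡ = trans (cong (w ^_) (sym (m∸n+n≡m (≤-trans (m≤n*m k 2) (feasible⇒2k≤T k 0<k feasible)))))
                (^-distribˡ-+-* w (T ∸ k) k)
    lemma₁ : ∀ p q → 32 * p * (4 * q) ≡ 128 * p * q
    lemma₁ = solve-∀
    lemma₂ : ∀ m c r p → m * c * (32 * (r * p)) ≡ 32 * p * (m * (c * r))
    lemma₂ = solve-∀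

  feasible⇒2*m^T*[m∸1]*joint≤3*m*single² : ∀ k → 0 < k → Feasible k →
    2 * m G ^ T * ((m G ∸ 1) * joint T k k) ≤ 3 * m G * (single T k * single T k)
  feasible⇒2*m^T*[m∸1]*joint≤3*m*single² k 0<k feasible =
    *-cancelˡ-≤ W {{m*n≢0 (w ^ k) (w ^ k) {{m^n≢0 w k}} {{m^n≢0 w k}}}} (begin
      W * (2 * M * (w * B))                   ≡⟨ lemma₁ (w ^ k) M w B ⟩
      2 * w * (B * M * w ^ k * w ^ k)         ≤⟨ *-monoʳ-≤ (2 * w) (scaledJoint≤scaledSingle² T k k) ⟩
      2 * w * (A * m G ^ k * (A * m G ^ k))   ≡⟨ lemma₂ w A (m G ^ k) ⟩
      w * (A * A) * (2 * (m G ^ k * m G ^ k)) ≤⟨ *-monoʳ-≤ (w * (A * A)) 2mᵏmᵏ≤3W ⟩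
      w * (A * A) * (3 * W)                   ≤⟨ *-monoˡ-≤ (3 * W) (*-monoˡ-≤ (A * A) (m∸n≤m (m G) 1)) ⟩
      m G * (A * A) * (3 * W)                 ≡⟨ lemma₃ (m G) (A * A) W ⟩
      W * (3 * m G * (A * A))                 ∎)
    where
    open ≤-Reasoning
    w = m G ∸ 1
    W = w ^ k * w ^ k
    M = m G ^ T
    A = single T k
    B = joint T k k
    x^[2k]≡xᵏ*xᵏ : ∀ x → x ^ (2 * k) ≡ x ^ k * x ^ k
    x^[2k]≡xᵏ*xᵏ x = trans (cong (λ e → x ^ (k + e)) (+-identityʳ k)) (^-distribˡ-+-* x k k)
    6k≤m = feasible⇒6k≤m k 0<k feasible
    2m≤3[m∸2k] : 2 * m G ≤ 3 * (m G ∸ 2 * k)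
    2m≤3[m∸2k] = +-cancelˡ-≤ (3 * (2 * k)) _ _ (begin
      3 * (2 * k) + 2 * m G           ≡⟨ cong (_+ 2 * m G) (*-assoc 3 2 k) ⟨
      6 * k + 2 * m G                 ≤⟨ +-monoˡ-≤ (2 * m G) 6k≤m ⟩
      3 * m G                         ≡⟨ cong (3 *_) (m+[n∸m]≡n (≤-trans (*-monoˡ-≤ k (m≤m+n 2 4)) 6k≤m)) ⟨
      3 * (2 * k + (m G ∸ 2 * k))     ≡⟨ *-distribˡ-+ 3 (2 * k) _ ⟩
      3 * (2 * k) + 3 * (m G ∸ 2 * k) ∎)
    2mᵏmᵏ≤3W : 2 * (m G ^ k * m G ^ k) ≤ 3 * W
    2mᵏmᵏ≤3W = subst₂ (λ p q → 2 * p ≤ 3 * q) (x^[2k]≡xᵏ*xᵏ (m G)) (x^[2k]≡xᵏ*xᵏ w)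
                 (^-ratio (m G) (2 * k) 2 3 2m≤3[m∸2k])
    lemma₁ : ∀ q M w b → q * q * (2 * M * (w * b)) ≡ 2 * w * (b * M * q * q)
    lemma₁ = solve-∀
    lemma₂ : ∀ w a p → 2 * w * (a * p * (a * p)) ≡ w * (a * a) * (2 * (p * p))
    lemma₂ = solve-∀
    lemma₃ : ∀ m a W → m * a * (3 * W) ≡ W * (3 * m * a)
    lemma₃ = solve-∀

  feasible⇒k*m^T≤8*OPTsum : ∀ k → Feasible k → k * m G ^ T ≤ 8 * OPTsum G T
  feasible⇒k*m^T≤8*OPTsum zero      _        = z≤n
  feasible⇒k*m^T≤8*OPTsum k@(suc _) feasible = k*m^T≤8*OPTsum G T k
    (feasible⇒4*m^T≤m*single k z<s feasible) (feasible⇒2*m^T*[m∸1]*joint≤3*m*single² k z<s feasible)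

  feasible⇒[k+4]*m^T≤12*OPTsum : 0 < T → ∀ k → Feasible k → (suc k + 3) * m G ^ T ≤ 12 * OPTsum G T
  feasible⇒[k+4]*m^T≤12*OPTsum 0<T k feasible = begin
    (suc k + 3) * m G ^ T
      ≡⟨ lemma k (m G ^ T) ⟩
    k * m G ^ T + 4 * m G ^ T
      ≤⟨ +-mono-≤ (feasible⇒k*m^T≤8*OPTsum k feasible) (*-monoʳ-≤ 4 (m^T≤OPTsum G T 0<T)) ⟩
    8 * OPTsum G T + 4 * OPTsum G T
      ≡⟨ *-distribʳ-+ (OPTsum G T) 8 4 ⟨
    12 * OPTsum G T ∎
    where
    open ≤-Reasoning
    lemma : ∀ k M → (suc k + 3) * M ≡ k * M + 4 * M
    lemma = solve-∀

  n^b<2^a⇒8b<a : ∀ a b → n ^ b < 2 ^ a → 8 * b < a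
  n^b<2^a⇒8b<a a b nᵇ<2ᵃ = ^-cancelˡ-< 2 (begin-strict
    2 ^ (8 * b) ≡⟨ ^-*-assoc 2 8 b ⟨
    256 ^ b     ≤⟨ ^-monoˡ-≤ b 256≤n ⟩
    n ^ b       <⟨ nᵇ<2ᵃ ⟩
    2 ^ a       ∎)
    where open ≤-Reasoning

  n^b<2^a⇒8Tb≤2ma : ∀ a b → n ^ b < 2 ^ a → 8 * (T * b) ≤ 2 * m G * a
  n^b<2^a⇒8Tb≤2ma a b nᵇ<2ᵃ =
    ≤-trans (≤-reflexive (*-CS.x∙yz≈y∙xz 8 T b)) (*-mono-≤ T≤2m (<⇒≤ (n^b<2^a⇒8b<a a b nᵇ<2ᵃ)))

  infeasible⇒n*[Tb]^[k+4]≤[2ma]^[k+4] : ∀ k a b → Feasible k → ¬ Feasible (suc k) → n ^ b < 2 ^ a →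
    n * (T * b) ^ (suc k + 3) ≤ (2 * m G * a) ^ (suc k + 3)
  infeasible⇒n*[Tb]^[k+4]≤[2ma]^[k+4] k a b feasible infeasible nᵇ<2ᵃ = begin
    n * y ^ (suc k + 3)       ≡⟨ cong (n *_) (^-distribˡ-+-* y (suc k) 3) ⟩
    n * (y ^ suc k * y ^ 3)   ≡⟨ *-assoc n _ _ ⟨
    n * y ^ suc k * y ^ 3     ≤⟨ *-monoˡ-≤ (y ^ 3) nyᵏ⁺¹≤256xᵏ⁺¹ ⟩
    256 * x ^ suc k * y ^ 3   ≡⟨ *-CS.xy∙z≈y∙xz 256 (x ^ suc k) (y ^ 3) ⟩
    x ^ suc k * (256 * y ^ 3) ≤⟨ *-monoʳ-≤ (x ^ suc k) (*-monoˡ-≤ (y ^ 3) (m≤m+n 256 256)) ⟩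
    x ^ suc k * (512 * y ^ 3) ≡⟨ cong (x ^ suc k *_) (^-distrib-* 8 y 3) ⟨
    x ^ suc k * (8 * y) ^ 3   ≤⟨ *-monoʳ-≤ (x ^ suc k) (^-monoˡ-≤ 3 (n^b<2^a⇒8Tb≤2ma a b nᵇ<2ᵃ)) ⟩
    x ^ suc k * x ^ 3         ≡⟨ ^-distribˡ-+-* x (suc k) 3 ⟨
    x ^ (suc k + 3)           ∎
    where
    open ≤-Reasoning
    x = 2 * m G * a
    y = T * b
    2[1+k]b<a : 2 * suc k * b < a
    2[1+k]b<a = ^-cancelˡ-< 2 (begin-strict
      2 ^ (2 * suc k * b) ≡⟨ trans (cong (_^ b) (^-*-assoc 2 2 (suc k))) (^-*-assoc 2 (2 * suc k) b) ⟨
      (4 ^ suc k) ^ b     ≤⟨ ^-monoˡ-≤ b (≤-trans (4^[1+k]≤256*[2k]^k k) (feasible⇒256*[2k]^k≤n k feasible)) ⟩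
      n ^ b               <⟨ nᵇ<2ᵃ ⟩
      2 ^ a               ∎)
    nyᵏ⁺¹≤256xᵏ⁺¹ : n * y ^ suc k ≤ 256 * x ^ suc k
    nyᵏ⁺¹≤256xᵏ⁺¹ = begin
      n * (T * b) ^ suc k
        ≡⟨ cong (n *_) (^-distrib-* T b (suc k)) ⟩
      n * (T ^ suc k * b ^ suc k)
        ≡⟨ *-assoc n (T ^ suc k) (b ^ suc k) ⟨
      n * T ^ suc k * b ^ suc k
        ≤⟨ *-monoˡ-≤ (b ^ suc k) (<⇒≤ (≰⇒> infeasible)) ⟩
      256 * (4 * suc k * m G) ^ suc k * b ^ suc k
        ≡⟨ *-assoc 256 ((4 * suc k * m G) ^ suc k) (b ^ suc k) ⟩
      256 * ((4 * suc k * m G) ^ suc k * b ^ suc k)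
        ≡⟨ cong (256 *_) (^-distrib-* (4 * suc k * m G) b (suc k)) ⟨
      256 * (4 * suc k * m G * b) ^ suc k
        ≡⟨ cong (λ z → 256 * z ^ suc k) (lemma k (m G) b) ⟩
      256 * (2 * m G * (2 * suc k * b)) ^ suc k
        ≤⟨ *-monoʳ-≤ 256 (^-monoˡ-≤ (suc k) (*-monoʳ-≤ (2 * m G) (<⇒≤ 2[1+k]b<a))) ⟩
      256 * x ^ suc k ∎
      where
      lemma : ∀ k m b → 4 * suc k * m * b ≡ 2 * m * (2 * suc k * b)
      lemma = solve-∀

  feasible? : Decidable Feasible
  feasible? k = 256 * (4 * k * m G) ^ k ≤? n * T ^ k

  feasible-0 : Feasible 0
  feasible-0 = ≤-trans 256≤n (≤-reflexive (sym (*-identityʳ n)))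

  last-feasible : ∃ λ k → Feasible k × ¬ Feasible (suc k)
  last-feasible = boundary feasible? feasible-0 n (λ feasible → <-irrefl refl (feasible⇒k<n n feasible))

  log-ratio-bound : 0 < T → LogRatioBound 1 12 n (m G) T (OPTsum G T) (m G ^ T)
  log-ratio-bound 0<T a b _ premise with 2 ^ a ≤? n ^ b
  ... | yes 2ᵃ≤nᵇ = 2ᵃ≤nᵇ
  ... | no  2ᵃ≰nᵇ = contradiction premise (≤⇒≯ (amplified last-feasible))
    where
    M = m G ^ T
    K = 12 * OPTsum G T
    nᵇ<2ᵃ : n ^ b < 2 ^ a
    nᵇ<2ᵃ = ≰⇒> 2ᵃ≰nᵇ
    amplified : (∃ λ k → Feasible k × ¬ Feasible (suc k)) →
                n ^ (1 * M) * T ^ K * b ^ K ≤ (2 * m G) ^ K * a ^ K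
    amplified (k , feasible , infeasible) = begin
      n ^ (1 * M) * T ^ K * b ^ K
        ≡⟨ cong (λ e → n ^ e * T ^ K * b ^ K) (*-identityˡ M) ⟩
      n ^ M * T ^ K * b ^ K
        ≡⟨ *-assoc (n ^ M) (T ^ K) (b ^ K) ⟩
      n ^ M * (T ^ K * b ^ K)
        ≡⟨ cong (n ^ M *_) (^-distrib-* T b K) ⟨
      n ^ M * (T * b) ^ K
        ≤⟨ n*y^J≤x^J⇒n^M*y^K≤x^K (suc k + 3) M K
             (infeasible⇒n*[Tb]^[k+4]≤[2ma]^[k+4] k a b feasible infeasible nᵇ<2ᵃ)
             (≤-trans (m≤n*m (T * b) 8) (n^b<2^a⇒8Tb≤2ma a b nᵇ<2ᵃ))
             (feasible⇒[k+4]*m^T≤12*OPTsum 0<T k feasible) ⟩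
      (2 * m G * a) ^ K
        ≡⟨ ^-distrib-* (2 * m G) a K ⟩
      (2 * m G) ^ K * a ^ K ∎
      where open ≤-Reasoning

claim4p5 : ((n : ℕ) (G : Graph n) → 1ℚ ≤ℚ dav G → (T : ℕ) →
    frac (2 * T) 1 *ℚ ρ* G ≤ℚ OPT G T *ℚ (frac n 1 *ℚ dav G))
    × Σ ℕ (λ c₁ → Σ ℕ (λ c₂ → Σ ℕ (λ n₀ → 1 ≤ c₁ × 1 ≤ c₂ ×
    ((n : ℕ) → n₀ ≤ n → (G : Graph n) → 1ℚ ≤ℚ dav G →
    (T : ℕ) → 1 ≤ T → T ≤ n →
    LogRatioBound c₁ c₂ n (m G) T (OPTsum G T) (m G ^ T)))))
claim4p5 = density-lower-bound , 1 , 12 , 256 , s≤s z≤n , s≤s z≤n ,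
  λ n 256≤n G 1≤dav T 0<T T≤n →
    LogBound.log-ratio-bound G 256≤n (proj₂ (1≤dav⇒0<n≤2m G 1≤dav)) T T≤n 0<T
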